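{- Let $M$ be a maximal planar graph, an $n$-semi-MPG, or an $(n_1,n_2,\ldots,n_k)$-semi-MPG, where two outer facets are allowed to share edges. The following are equivalent: (a) $M$ is 4-colorable; (b) $M$ has an RGB-tiling such that along every $m$-cycle in $M$ the numbers of red, green and blue edges are all even if $m$ is even and all odd if $m$ is odd; (c) $M$ has an RGB-tiling such that along every $n_i$-gon outer facet the numbers of red, green and blue edges are all even if $n_i$ is even and all odd if $n_i$ is odd; (d) $M$ has a grand R-tiling without red odd-cycles.
   Context: A maximal planar graph (MPG) is a simple plane graph all of whose faces, including the outer one, are triangles. A semi-MPG is a connected simple plane graph in which every face is a triangle except some designated faces called outer facets (border faces); an $(n_1,\ldots,n_k)$-semi-MPG has $k$ outer facets of sizes $n_1,\ldots,n_k$, and an $n$-semi-MPG has one outer facet of size $n$. 3-gon outer facets are allowed and are not treated as triangular faces for tilings. An edge shared by two outer facets lies in no triangular face and is counted with multiplicity 2 when counting edges along outer facets. An R-tiling is a map $T_r:E(M)\to\{\text{red},\text{black}\}$ such that every triangular face that is not an outer facet has exactly one red edge and two black edges. An R-tiling is grand if $V(M)=V_{13}\uplus V_{24}$ for some partition such that the spanning subgraph of black edges is bipartite with parts $V_{13},V_{24}$ and no red edge joins $V_{13}$ to $V_{24}$. An RGB-tiling is a map $E(M)\to\{\text{red},\text{green},\text{blue}\}$ such that every triangular face that is not an outer facet has three edges of three different colors. A red odd-cycle is an odd-length cycle all of whose edges are red. 4-colorable means having a proper vertex-coloring with 4 colors. -}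

module Defs where

open import Data.Nat using (ℕ; zero; suc; _+_; _*_; _≤ᵇ_; _%_)
open import Data.Bool using (Bool; true; false; _∧_; _∨_; if_then_else_)
open import Data.Fin using (Fin; toℕ) renaming (zero to fzero; suc to fsuc)
open import Data.Fin.Properties using () renaming (_≟_ to _≟ᶠ_)
open import Data.Product using (Σ; ∃; _×_; _,_)
open import Data.Sum using (_⊎_)
open import Relation.Nullary using (¬_)
open import Relation.Nullary.Decidable using (⌊_⌋)
open import Relation.Binary.PropositionalEquality using (_≡_; _≢_)

iter : {A : Set} → (A → A) → ℕ → A → A
iter f zero    x = x
iter f (suc k) x = f (iter f k x)

countF : {m : ℕ} → (Fin m → Bool) → ℕ
countF {zero}  p = 0
countF {suc m} p = (if p fzero then 1 else 0) + countF (λ i → p (fsuc i))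

anyBelow : ℕ → (ℕ → Bool) → Bool
anyBelow zero    p = false
anyBelow (suc n) p = p n ∨ anyBelow n p

allBelow : ℕ → (ℕ → Bool) → Bool
allBelow zero    p = true
allBelow (suc n) p = p n ∧ allBelow n p

_==ᶠ_ : {n : ℕ} → Fin n → Fin n → Bool
i ==ᶠ j = ⌊ i ≟ᶠ j ⌋

-- Plane graphs as combinatorial maps (rotation systems).
-- Darts Fin nD; α = opposite dart (fixed-point-free involution);
-- σ = rotation around the tail vertex (a permutation);
-- φ = σ ∘ α = face permutation: the φ-orbits are the faces, traced as
-- closed walks (dart d goes from vert d to vert (α d), and φ d starts
-- at vert (α d)).

-- connectivity of the map (the group generated by σ, α is transitive)
data Reach {nD : ℕ} (α σ : Fin nD → Fin nD) : Fin nD → Fin nD → Set where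
  here  : ∀ {d} → Reach α σ d d
  stepσ : ∀ {d e} → Reach α σ (σ d) e → Reach α σ d e
  stepα : ∀ {d e} → Reach α σ (α d) e → Reach α σ d e

-- d and d' lie on the same φ-orbit (an orbit has at most nD elements)
sameOrbit : {nD : ℕ} → (Fin nD → Fin nD) → Fin nD → Fin nD → Bool
sameOrbit {nD} φ d d' = anyBelow nD (λ k → iter φ k d ==ᶠ d')

orbitRep : {nD : ℕ} → (Fin nD → Fin nD) → Fin nD → Bool
orbitRep {nD} φ d = allBelow nD (λ k → toℕ d ≤ᵇ toℕ (iter φ k d))

orbitCount : {nD : ℕ} → (Fin nD → Fin nD) → ℕ
orbitCount φ = countF (orbitRep φ)

-- A connected simple plane graph M, every face of which is a triangle
-- except the designated outer facets (outer d ≡ true iff the face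
-- containing dart d is an outer facet).  With no outer facet this is an
-- MPG; with one an n-semi-MPG; with k an (n₁,…,n_k)-semi-MPG.  Outer
-- facets may share edges (an edge whose two darts lie on two outer facets).
record SemiMPG : Set where
  field
    nD nV      : ℕ
    α σ σ⁻     : Fin nD → Fin nD
    vert       : Fin nD → Fin nV
    outer      : Fin nD → Bool
    α-invol    : ∀ d → α (α d) ≡ d
    α-nofix    : ∀ d → α d ≢ d
    σσ⁻        : ∀ d → σ (σ⁻ d) ≡ d
    σ⁻σ        : ∀ d → σ⁻ (σ d) ≡ d
    -- vertices are exactly the σ-orbits
    vert-σ     : ∀ d → vert (σ d) ≡ vert d
    vert-orbit : ∀ d d' → vert d ≡ vert d' → ∃ λ k → iter σ k d ≡ d'
    vert-surj  : ∀ v → ∃ λ d → vert d ≡ v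
    connected  : ∀ d d' → Reach α σ d d'
    loopless   : ∀ d → vert (α d) ≢ vert d
    no-multi   : ∀ d d' → vert d ≡ vert d' → vert (α d) ≡ vert (α d') → d ≡ d'
    -- plane (genus 0): V − E + F = 2, with E = nD/2
    euler      : 2 * nV + 2 * orbitCount (λ d → σ (α d)) ≡ nD + 4
    -- outer facets are unions of faces
    outer-φ    : ∀ d → outer (σ (α d)) ≡ outer d
    triangular : ∀ d → outer d ≡ false → iter (λ e → σ (α e)) 3 d ≡ d

  φ : Fin nD → Fin nD
  φ d = σ (α d)

  -- Cycles: an m-cycle (m ≥ 3) is given by darts w 0,…,w (m-1), where
  -- dart w i goes from the i-th vertex to the (i+1 mod m)-th vertex,
  -- and the m vertices are pairwise distinct.
  IsCycle : (m : ℕ) → (Fin m → Fin nD) → Set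
  IsCycle m w =
    (3 Data.Nat.≤ m)
    × (∀ i j → (suc (toℕ i) ≡ toℕ j ⊎ (suc (toℕ i) ≡ m × toℕ j ≡ 0))
             → vert (α (w i)) ≡ vert (w j))
    × (∀ i j → vert (w i) ≡ vert (w j) → i ≡ j)

  FourColorable : Set
  FourColorable = Σ (Fin nV → Fin 4) λ f → ∀ d → f (vert d) ≢ f (vert (α d))

  inFace : Fin nD → Fin nD → Bool
  inFace d = sameOrbit φ d

  -- R-tilings (red = true, black = false)
  IsRTiling : (Fin nD → Bool) → Set
  IsRTiling T =
    (∀ d → T (α d) ≡ T d)
    × (∀ d → outer d ≡ false →
         (if T d then 1 else 0) + (if T (φ d) then 1 else 0)
           + (if T (φ (φ d)) then 1 else 0) ≡ 1)

  IsGrand : (Fin nD → Bool) → Set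
  IsGrand T = Σ (Fin nV → Bool) λ part →
    (∀ d → T d ≡ false → part (vert d) ≢ part (vert (α d)))
    × (∀ d → T d ≡ true → part (vert d) ≡ part (vert (α d)))

  HasRedOddCycle : (Fin nD → Bool) → Set
  HasRedOddCycle T = Σ ℕ λ m → Σ (Fin m → Fin nD) λ w →
    IsCycle m w × (m % 2 ≡ 1) × (∀ i → T (w i) ≡ true)

data RGB : Set where
  red green blue : RGB

_==c_ : RGB → RGB → Bool
red   ==c red   = true
green ==c green = true
blue  ==c blue  = true
_     ==c _     = false

module _ (M : SemiMPG) where
  open SemiMPG M

  IsRGBTiling : (Fin nD → RGB) → Set
  IsRGBTiling c =
    (∀ d → c (α d) ≡ c d)
    × (∀ d → outer d ≡ false →
         (c d ≢ c (φ d)) × (c (φ d) ≢ c (φ (φ d))) × (c d ≢ c (φ (φ d))))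

  CycleParity : (Fin nD → RGB) → Set
  CycleParity c = ∀ m (w : Fin m → Fin nD) → IsCycle m w → ∀ col →
    countF (λ i → c (w i) ==c col) % 2 ≡ m % 2

  -- along every outer facet (size n_i = number of its darts), each
  -- colour count has the parity of n_i
  OuterParity : (Fin nD → RGB) → Set
  OuterParity c = ∀ d → outer d ≡ true → ∀ col →
    countF (λ d' → inFace d d' ∧ (c d' ==c col)) % 2 ≡ countF (inFace d) % 2

  StmtA : Set
  StmtA = FourColorable
  StmtB : Set
  StmtB = Σ (Fin nD → RGB) λ c → IsRGBTiling c × CycleParity c
  StmtC : Set
  StmtC = Σ (Fin nD → RGB) λ c → IsRGBTiling c × OuterParity c
  StmtD : Set
  StmtD = Σ (Fin nD → Bool) λ T → IsRTiling T × IsGrand T × ¬ HasRedOddCycle T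

-- An RGB-colouring is a pair of 𝔽₂-edge-labellings (bit₁, bit₂) never vanishing together, and
-- a four-colouring a pair of 𝔽₂-vertex-potentials whose coboundaries never vanish together; three
-- distinct colours are three nonzero vectors of 𝔽₂², which sum to zero. Coboundaries telescope
-- to zero along cycles and facets, which gives (a) ⇒ (b), (c), and (d) with red edges where the
-- first potential is constant and the second alternates. Conversely a labelling that is even
-- along every cycle is even along every closed walk, hence a coboundary: this gives (b) ⇒ (a),
-- and (d) ⇒ (a) as the red graph is bipartite. For (c) ⇒ (a) the labellings are only even around
-- faces; by Euler's formula the darts off a spanning tree form a spanning tree of the dual, and
-- the labelling minus its tree potential lives on that dual tree and is even at every dual vertex,
-- so it vanishes.

module Submission where

open import Defs
open import Data.Product using (Σ; ∃; _×_; _,_; proj₁; proj₂)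
open import Function.Bundles using (_⇔_; mk⇔; Equivalence)
open import Data.Nat using (ℕ; zero; suc; _+_; _*_; _∸_; _≤_; _<_; z≤n; s≤s; _%_; _/_; _≤ᵇ_; _≤?_)
open import Data.Nat.Properties
open import Data.Nat.DivMod using (m≡m%n+[m/n]*n; m%n<n; [m+n]%n≡m%n)
open import Data.Bool using (Bool; true; false; not; _∧_; _∨_; _xor_; if_then_else_; T)
import Data.Bool.Properties as 𝔹
open import Data.Fin using (Fin; toℕ; inject₁; fromℕ) renaming (zero to fzero; suc to fsuc)
import Data.Fin.Properties as FinP
open import Data.Sum using (_⊎_; inj₁; inj₂; [_,_]′)
open import Data.Empty using (⊥; ⊥-elim)
open import Data.List using (List; []; _∷_; _++_; length; lookup)
import Data.List.Properties as ListP
open import Relation.Nullary using (¬_; Dec; yes; no)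
open import Relation.Nullary.Decidable using (dec-true; dec-false; isYes≗does; ¬?; _→-dec_; _×-dec_; from-yes)
open import Relation.Binary.Definitions using (DecidableEquality; tri<; tri≈; tri>)
open import Relation.Binary.PropositionalEquality
open import Algebra.Bundles using (CommutativeRing)
open import Algebra.Properties.CommutativeSemigroup
  (CommutativeRing.+-commutativeSemigroup 𝔹.xor-∧-commutativeRing)
  using () renaming (interchange to xor-interchange)

true≢false : true ≢ false
true≢false ()

true⊎false : (b : Bool) → b ≡ true ⊎ b ≡ false
true⊎false true  = inj₁ refl
true⊎false false = inj₂ refl

Bool-ext : ∀ {a b} → (a ≡ true → b ≡ true) → (b ≡ true → a ≡ true) → a ≡ b
Bool-ext {true}  f g = sym (f refl)
Bool-ext {false} {true}  f g = g refl
Bool-ext {false} {false} f g = refl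

T⇒≡true : ∀ {b} → T b → b ≡ true
T⇒≡true = Equivalence.to 𝔹.T-≡

≡true⇒T : ∀ {b} → b ≡ true → T b
≡true⇒T = Equivalence.from 𝔹.T-≡

∨-introˡ : ∀ a b → a ≡ true → a ∨ b ≡ true
∨-introˡ true b _ = refl

∨-introʳ : ∀ a b → b ≡ true → a ∨ b ≡ true
∨-introʳ true  b _ = refl
∨-introʳ false b e = e

∨-elim : ∀ a b → a ∨ b ≡ true → a ≡ true ⊎ b ≡ true
∨-elim true  b _ = inj₁ refl
∨-elim false b e = inj₂ e

∧-elimˡ : ∀ a b → a ∧ b ≡ true → a ≡ true
∧-elimˡ true b _ = refl

∧-elimʳ : ∀ a b → a ∧ b ≡ true → b ≡ true
∧-elimʳ true b e = e

∧-intro : ∀ {a b} → a ≡ true → b ≡ true → a ∧ b ≡ true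
∧-intro refl refl = refl

xor≡false⇒≡ : ∀ a b → a xor b ≡ false → a ≡ b
xor≡false⇒≡ true  true  _ = refl
xor≡false⇒≡ false false _ = refl

≡⇒xor≡false : ∀ {a b} → a ≡ b → a xor b ≡ false
≡⇒xor≡false {a} refl = 𝔹.xor-same a

≢⇒xor≡true : ∀ a b → a ≢ b → a xor b ≡ true
≢⇒xor≡true true  true  ne = ⊥-elim (ne refl)
≢⇒xor≡true true  false _  = refl
≢⇒xor≡true false true  _  = refl
≢⇒xor≡true false false ne = ⊥-elim (ne refl)

xor-cancel-middle : ∀ a b c → a xor b ≡ b xor c → a ≡ c
xor-cancel-middle true  true  true  _ = refl
xor-cancel-middle true  false true  _ = refl
xor-cancel-middle false true  false _ = refl
xor-cancel-middle false false false _ = refl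
xor-cancel-middle true  true  false ()
xor-cancel-middle true  false false ()
xor-cancel-middle false true  true  ()
xor-cancel-middle false false true  ()

xor-xor-cancelʳ : ∀ a b → (a xor b) xor b ≡ a
xor-xor-cancelʳ a b = begin
  (a xor b) xor b ≡⟨ 𝔹.xor-assoc a b b ⟩
  a xor (b xor b) ≡⟨ cong (a xor_) (𝔹.xor-same b) ⟩
  a xor false     ≡⟨ 𝔹.xor-identityʳ a ⟩
  a               ∎
  where open ≡-Reasoning

Distinct3 : {A : Set} → A → A → A → Set
Distinct3 x y z = x ≢ y × y ≢ z × x ≢ z

Distinct3-map⁻ : ∀ {A B : Set} (f : A → B) {x y z} → Distinct3 (f x) (f y) (f z) → Distinct3 x y z
Distinct3-map⁻ f (x≢y , y≢z , x≢z) = (λ e → x≢y (cong f e)) , (λ e → y≢z (cong f e)) , (λ e → x≢z (cong f e))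

module _ {n : ℕ} where

  ==ᶠ-refl : (i : Fin n) → (i ==ᶠ i) ≡ true
  ==ᶠ-refl i = trans (isYes≗does (i FinP.≟ i)) (dec-true (i FinP.≟ i) refl)

  ≡⇒==ᶠ : {i j : Fin n} → i ≡ j → (i ==ᶠ j) ≡ true
  ≡⇒==ᶠ {i} refl = ==ᶠ-refl i

  ≢⇒==ᶠ : {i j : Fin n} → i ≢ j → (i ==ᶠ j) ≡ false
  ≢⇒==ᶠ {i} {j} ne = trans (isYes≗does (i FinP.≟ j)) (dec-false (i FinP.≟ j) ne)

  ==ᶠ⇒≡ : {i j : Fin n} → (i ==ᶠ j) ≡ true → i ≡ j
  ==ᶠ⇒≡ {i} {j} e with i FinP.≟ j
  ... | yes p = p
  ==ᶠ⇒≡ () | no _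

  ==ᶠ-sym : (i j : Fin n) → (i ==ᶠ j) ≡ (j ==ᶠ i)
  ==ᶠ-sym i j = Bool-ext (λ e → ≡⇒==ᶠ (sym (==ᶠ⇒≡ e))) (λ e → ≡⇒==ᶠ (sym (==ᶠ⇒≡ e)))

odd : ℕ → Bool
odd zero    = false
odd (suc n) = not (odd n)

-- definitionally the summand of countF
ind : Bool → ℕ
ind b = if b then 1 else 0

odd-+ : ∀ a b → odd (a + b) ≡ odd a xor odd b
odd-+ zero    b = refl
odd-+ (suc a) b = trans (cong not (odd-+ a b)) (𝔹.not-distribˡ-xor (odd a) (odd b))

odd-ind : ∀ b → odd (ind b) ≡ b
odd-ind true  = refl
odd-ind false = refl

%2≡ind-odd : ∀ n → n % 2 ≡ ind (odd n)
%2≡ind-odd zero          = refl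
%2≡ind-odd (suc zero)    = refl
%2≡ind-odd (suc (suc n)) = begin
  (2 + n) % 2            ≡⟨ cong (_% 2) (+-comm 2 n) ⟩
  (n + 2) % 2            ≡⟨ [m+n]%n≡m%n n 2 ⟩
  n % 2                  ≡⟨ %2≡ind-odd n ⟩
  ind (odd n)            ≡⟨ cong ind (sym (𝔹.not-involutive (odd n))) ⟩
  ind (odd (suc (suc n))) ∎
  where open ≡-Reasoning

ind-injective : ∀ {a b} → ind a ≡ ind b → a ≡ b
ind-injective {true}  {true}  _ = refl
ind-injective {false} {false} _ = refl
ind-injective {true}  {false} ()
ind-injective {false} {true}  ()

%2≡⇒odd≡ : ∀ m n → m % 2 ≡ n % 2 → odd m ≡ odd n
%2≡⇒odd≡ m n e = ind-injective (trans (sym (%2≡ind-odd m)) (trans e (%2≡ind-odd n)))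

odd≡⇒%2≡ : ∀ m n → odd m ≡ odd n → m % 2 ≡ n % 2
odd≡⇒%2≡ m n e = trans (%2≡ind-odd m) (trans (cong ind e) (sym (%2≡ind-odd n)))

_⊆ᵇ_ : ∀ {m} → (Fin m → Bool) → (Fin m → Bool) → Set
p ⊆ᵇ q = ∀ i → p i ≡ true → q i ≡ true

countF-cong : ∀ {m} {p q : Fin m → Bool} → (∀ i → p i ≡ q i) → countF p ≡ countF q
countF-cong {zero}  e = refl
countF-cong {suc m} e = cong₂ _+_ (cong ind (e fzero)) (countF-cong (λ i → e (fsuc i)))

countF-none : ∀ {m} {p : Fin m → Bool} → (∀ i → p i ≡ false) → countF p ≡ 0
countF-none {zero}  e = refl
countF-none {suc m} e rewrite e fzero = countF-none (λ i → e (fsuc i))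

countF-all : ∀ {m} → countF {m} (λ _ → true) ≡ m
countF-all {zero}  = refl
countF-all {suc m} = cong suc (countF-all {m})

ind≤1 : ∀ b → ind b ≤ 1
ind≤1 true  = s≤s z≤n
ind≤1 false = z≤n

countF-≤ : ∀ {m} (p : Fin m → Bool) → countF p ≤ m
countF-≤ {zero}  p = z≤n
countF-≤ {suc m} p = +-mono-≤ (ind≤1 (p fzero)) (countF-≤ (λ i → p (fsuc i)))

ind-mono : ∀ {a b} → (a ≡ true → b ≡ true) → ind a ≤ ind b
ind-mono {true}  f rewrite f refl = ≤-refl
ind-mono {false} f = z≤n

countF-mono : ∀ {m} {p q : Fin m → Bool} → p ⊆ᵇ q → countF p ≤ countF q
countF-mono {zero}  s = z≤n
countF-mono {suc m} s = +-mono-≤ (ind-mono (s fzero)) (countF-mono (λ i → s (fsuc i)))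

countF-mono-< : ∀ {m} {p q : Fin m → Bool} → p ⊆ᵇ q → ∀ i → q i ≡ true → p i ≡ false →
                countF p < countF q
countF-mono-< {suc m} s fzero qi pi rewrite qi | pi = s≤s (countF-mono (λ i → s (fsuc i)))
countF-mono-< {suc m} {p} {q} s (fsuc i) qi pi =
  subst (_≤ ind (q fzero) + countF (λ j → q (fsuc j))) (+-suc (ind (p fzero)) _)
    (+-mono-≤ (ind-mono (s fzero)) (countF-mono-< (λ j → s (fsuc j)) i qi pi))

countF-⊆-≥ : ∀ {m} {p q : Fin m → Bool} → p ⊆ᵇ q → countF q ≤ countF p → q ⊆ᵇ p
countF-⊆-≥ {p = p} s le i qi with true⊎false (p i)
... | inj₁ pi = pi
... | inj₂ pi = ⊥-elim (<-irrefl refl (<-≤-trans (countF-mono-< s i qi pi) le))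

countF-pos : ∀ {m} (p : Fin m → Bool) i → p i ≡ true → 1 ≤ countF p
countF-pos p fzero    e rewrite e = s≤s z≤n
countF-pos p (fsuc i) e = ≤-trans (countF-pos (λ j → p (fsuc j)) i e) (m≤n+m _ (ind (p fzero)))

countF-∨ : ∀ {m} (p q : Fin m → Bool) → (∀ i → p i ∧ q i ≡ false) →
           countF (λ i → p i ∨ q i) ≡ countF p + countF q
countF-∨ {zero}  p q disj = refl
countF-∨ {suc m} p q disj with p fzero | q fzero | disj fzero
... | true  | false | _ = cong suc (countF-∨ (λ i → p (fsuc i)) (λ i → q (fsuc i)) (λ i → disj (fsuc i)))
... | false | true  | _ = trans (cong suc (countF-∨ (λ i → p (fsuc i)) (λ i → q (fsuc i)) (λ i → disj (fsuc i))))
                                (sym (+-suc _ _))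
... | false | false | _ = countF-∨ (λ i → p (fsuc i)) (λ i → q (fsuc i)) (λ i → disj (fsuc i))

countF-∧-split : ∀ {m} (p q : Fin m → Bool) →
                 countF p ≡ countF (λ i → p i ∧ q i) + countF (λ i → p i ∧ not (q i))
countF-∧-split p q = trans (countF-cong (λ i → split (p i) (q i)))
  (countF-∨ (λ i → p i ∧ q i) (λ i → p i ∧ not (q i)) (λ i → disjoint (p i) (q i)))
  where
  split : ∀ a b → a ≡ (a ∧ b) ∨ (a ∧ not b)
  split true  true  = refl
  split true  false = refl
  split false b     = refl
  disjoint : ∀ a b → (a ∧ b) ∧ (a ∧ not b) ≡ false
  disjoint true  true  = refl
  disjoint true  false = refl
  disjoint false b     = refl

countF-not : ∀ {m} (p : Fin m → Bool) → countF p + countF (λ i → not (p i)) ≡ m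
countF-not {m} p = begin
  countF p + countF (λ i → not (p i))
    ≡⟨ sym (countF-∧-split (λ _ → true) p) ⟩
  countF {m} (λ _ → true)
    ≡⟨ countF-all ⟩
  m ∎
  where open ≡-Reasoning

countF-single : ∀ {m} (j : Fin m) (g : Fin m → Bool) → countF (λ i → (i ==ᶠ j) ∧ g i) ≡ ind (g j)
countF-single {suc m} fzero g = begin
  ind (g fzero) + countF (λ i → (fsuc i ==ᶠ fzero) ∧ g (fsuc i))
    ≡⟨ cong (ind (g fzero) +_) (countF-none (λ i → cong (_∧ g (fsuc i)) (≢⇒==ᶠ {i = fsuc i} {fzero} (λ ())))) ⟩
  ind (g fzero) + 0
    ≡⟨ +-identityʳ _ ⟩
  ind (g fzero) ∎
  where open ≡-Reasoning
countF-single {suc m} (fsuc j) g = begin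
  ind ((fzero ==ᶠ fsuc j) ∧ g fzero) + countF (λ i → (fsuc i ==ᶠ fsuc j) ∧ g (fsuc i))
    ≡⟨ cong₂ _+_ (cong (λ b → ind (b ∧ g fzero)) (≢⇒==ᶠ {i = fzero} {fsuc j} (λ ())))
                 (countF-cong (λ i → cong (_∧ g (fsuc i)) (==ᶠ-suc i j))) ⟩
  countF (λ i → (i ==ᶠ j) ∧ g (fsuc i))
    ≡⟨ countF-single j (λ i → g (fsuc i)) ⟩
  ind (g (fsuc j)) ∎
  where
  open ≡-Reasoning
  ==ᶠ-suc : ∀ {m} (i j : Fin m) → (fsuc i ==ᶠ fsuc j) ≡ (i ==ᶠ j)
  ==ᶠ-suc i j = Bool-ext (λ e → ≡⇒==ᶠ (FinP.suc-injective (==ᶠ⇒≡ e)))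
                         (λ e → ≡⇒==ᶠ (cong fsuc (==ᶠ⇒≡ e)))

countF-last : ∀ {m} (p : Fin (suc m) → Bool) →
              countF p ≡ countF (λ i → p (inject₁ i)) + ind (p (fromℕ m))
countF-last {zero}  p = +-comm (ind (p fzero)) 0
countF-last {suc m} p = trans (cong (ind (p fzero) +_) (countF-last (λ i → p (fsuc i))))
                              (sym (+-assoc (ind (p fzero)) _ _))

countF-rotate : ∀ {k} (u v : Fin (suc k) → Bool) →
                (∀ i → v (inject₁ i) ≡ u (fsuc i)) → v (fromℕ k) ≡ u fzero → countF v ≡ countF u
countF-rotate {k} u v shift last = begin
  countF v                                            ≡⟨ countF-last v ⟩
  countF (λ i → v (inject₁ i)) + ind (v (fromℕ k))    ≡⟨ cong₂ _+_ (countF-cong shift) (cong ind last) ⟩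
  countF (λ i → u (fsuc i)) + ind (u fzero)           ≡⟨ +-comm _ (ind (u fzero)) ⟩
  countF u                                            ∎
  where open ≡-Reasoning

sumF : ∀ {n} → (Fin n → ℕ) → ℕ
sumF {zero}  f = 0
sumF {suc n} f = f fzero + sumF (λ i → f (fsuc i))

sumF-cong : ∀ {n} {f g : Fin n → ℕ} → (∀ i → f i ≡ g i) → sumF f ≡ sumF g
sumF-cong {zero}  e = refl
sumF-cong {suc n} e = cong₂ _+_ (e fzero) (sumF-cong (λ i → e (fsuc i)))

sumF-mono : ∀ {n} {f g : Fin n → ℕ} → (∀ i → f i ≤ g i) → sumF f ≤ sumF g
sumF-mono {zero}  e = z≤n
sumF-mono {suc n} e = +-mono-≤ (e fzero) (sumF-mono (λ i → e (fsuc i)))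

sumF-+ : ∀ {n} (f g : Fin n → ℕ) → sumF (λ i → f i + g i) ≡ sumF f + sumF g
sumF-+ {zero}  f g = refl
sumF-+ {suc n} f g = trans (cong (f fzero + g fzero +_) (sumF-+ (λ i → f (fsuc i)) (λ i → g (fsuc i))))
                           (+-+-comm (f fzero) (g fzero) _ _)
  where
  +-+-comm : ∀ a b c d → a + b + (c + d) ≡ a + c + (b + d)
  +-+-comm a b c d = begin
    a + b + (c + d)   ≡⟨ +-assoc a b (c + d) ⟩
    a + (b + (c + d)) ≡⟨ cong (a +_) (+-comm b (c + d)) ⟩
    a + ((c + d) + b) ≡⟨ cong (a +_) (+-assoc c d b) ⟩
    a + (c + (d + b)) ≡⟨ cong (λ z → a + (c + z)) (+-comm d b) ⟩
    a + (c + (b + d)) ≡⟨ sym (+-assoc a c (b + d)) ⟩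
    a + c + (b + d)   ∎
    where open ≡-Reasoning

sumF-zero : ∀ {n} → sumF {n} (λ _ → 0) ≡ 0
sumF-zero {zero}  = refl
sumF-zero {suc n} = sumF-zero {n}

countF≡sumF : ∀ {m} (p : Fin m → Bool) → countF p ≡ sumF (λ i → ind (p i))
countF≡sumF {zero}  p = refl
countF≡sumF {suc m} p = cong (ind (p fzero) +_) (countF≡sumF (λ i → p (fsuc i)))

countF-fibres : ∀ {m n} (h : Fin m → Fin n) (p : Fin m → Bool) →
                countF p ≡ sumF (λ x → countF (λ d → (h d ==ᶠ x) ∧ p d))
countF-fibres {zero}  {n} h p = sym (sumF-zero {n})
countF-fibres {suc m} {n} h p = begin
  ind (p fzero) + countF (λ d → p (fsuc d))
    ≡⟨ cong₂ _+_ (sym head) (countF-fibres (λ d → h (fsuc d)) (λ d → p (fsuc d))) ⟩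
  sumF (λ x → ind ((h fzero ==ᶠ x) ∧ p fzero)) + sumF (λ x → countF (λ d → (h (fsuc d) ==ᶠ x) ∧ p (fsuc d)))
    ≡⟨ sym (sumF-+ (λ x → ind ((h fzero ==ᶠ x) ∧ p fzero)) _) ⟩
  sumF (λ x → countF (λ d → (h d ==ᶠ x) ∧ p d)) ∎
  where
  open ≡-Reasoning
  head : sumF (λ x → ind ((h fzero ==ᶠ x) ∧ p fzero)) ≡ ind (p fzero)
  head = begin
    sumF (λ x → ind ((h fzero ==ᶠ x) ∧ p fzero))
      ≡⟨ sumF-cong (λ x → cong (λ b → ind (b ∧ p fzero)) (==ᶠ-sym (h fzero) x)) ⟩
    sumF (λ x → ind ((x ==ᶠ h fzero) ∧ p fzero))
      ≡⟨ sym (countF≡sumF (λ x → (x ==ᶠ h fzero) ∧ p fzero)) ⟩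
    countF (λ x → (x ==ᶠ h fzero) ∧ p fzero)
      ≡⟨ countF-single (h fzero) (λ _ → p fzero) ⟩
    ind (p fzero) ∎

countF-permute : ∀ {m} (π π⁻ : Fin m → Fin m) → (∀ x → π (π⁻ x) ≡ x) → (∀ x → π⁻ (π x) ≡ x) →
                 (p : Fin m → Bool) → countF (λ d → p (π d)) ≡ countF p
countF-permute π π⁻ ππ⁻ π⁻π p = begin
  countF (λ d → p (π d))
    ≡⟨ countF-fibres π (λ d → p (π d)) ⟩
  sumF (λ x → countF (λ d → (π d ==ᶠ x) ∧ p (π d)))
    ≡⟨ sumF-cong (λ x → trans (countF-cong (fibre x)) (countF-single (π⁻ x) (λ _ → p x))) ⟩
  sumF (λ x → ind (p x))
    ≡⟨ sym (countF≡sumF p) ⟩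
  countF p ∎
  where
  open ≡-Reasoning
  π≡⇔≡π⁻ : ∀ x d → (π d ==ᶠ x) ≡ (d ==ᶠ π⁻ x)
  π≡⇔≡π⁻ x d = Bool-ext (λ e → ≡⇒==ᶠ (trans (sym (π⁻π d)) (cong π⁻ (==ᶠ⇒≡ e))))
                        (λ e → ≡⇒==ᶠ (trans (cong π (==ᶠ⇒≡ e)) (ππ⁻ x)))
  fibre : ∀ x d → (π d ==ᶠ x) ∧ p (π d) ≡ (d ==ᶠ π⁻ x) ∧ p x
  fibre x d with π d ==ᶠ x in e
  ... | true  = cong₂ _∧_ (trans (sym e) (π≡⇔≡π⁻ x d)) (cong p (==ᶠ⇒≡ e))
  ... | false = cong (_∧ p x) (trans (sym e) (π≡⇔≡π⁻ x d))

odd-countF-suc : ∀ {m} (p : Fin (suc m) → Bool) → odd (countF p) ≡ p fzero xor odd (countF (λ i → p (fsuc i)))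
odd-countF-suc p = trans (odd-+ (ind (p fzero)) _) (cong (_xor odd (countF (λ i → p (fsuc i)))) (odd-ind (p fzero)))

odd-countF-xor : ∀ {m} (a b : Fin m → Bool) →
                 odd (countF (λ i → a i xor b i)) ≡ odd (countF a) xor odd (countF b)
odd-countF-xor {zero}  a b = refl
odd-countF-xor {suc m} a b = begin
  odd (countF (λ i → a i xor b i))
    ≡⟨ odd-countF-suc (λ i → a i xor b i) ⟩
  (a fzero xor b fzero) xor odd (countF (λ i → a (fsuc i) xor b (fsuc i)))
    ≡⟨ cong ((a fzero xor b fzero) xor_) (odd-countF-xor (λ i → a (fsuc i)) (λ i → b (fsuc i))) ⟩
  (a fzero xor b fzero) xor (odd (countF (λ i → a (fsuc i))) xor odd (countF (λ i → b (fsuc i))))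
    ≡⟨ xor-interchange (a fzero) (b fzero) _ _ ⟩
  (a fzero xor odd (countF (λ i → a (fsuc i)))) xor (b fzero xor odd (countF (λ i → b (fsuc i))))
    ≡⟨ sym (cong₂ _xor_ (odd-countF-suc a) (odd-countF-suc b)) ⟩
  odd (countF a) xor odd (countF b) ∎
  where open ≡-Reasoning

odd-countF-∧-xor : ∀ {m} (P a b : Fin m → Bool) →
                   odd (countF (λ i → P i ∧ (a i xor b i)))
                     ≡ odd (countF (λ i → P i ∧ a i)) xor odd (countF (λ i → P i ∧ b i))
odd-countF-∧-xor P a b = trans (cong odd (countF-cong (λ i → 𝔹.∧-distribˡ-xor (P i) (a i) (b i))))
                               (odd-countF-xor (λ i → P i ∧ a i) (λ i → P i ∧ b i))

odd-countF-coboundary : ∀ {m} (π π⁻ : Fin m → Fin m) → (∀ x → π (π⁻ x) ≡ x) → (∀ x → π⁻ (π x) ≡ x) →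
                        (P a : Fin m → Bool) → (∀ d → P (π d) ≡ P d) →
                        odd (countF (λ d → P d ∧ (a d xor a (π d)))) ≡ false
odd-countF-coboundary π π⁻ ππ⁻ π⁻π P a Pπ = begin
  odd (countF (λ d → P d ∧ (a d xor a (π d))))
    ≡⟨ odd-countF-∧-xor P a (λ d → a (π d)) ⟩
  odd (countF (λ d → P d ∧ a d)) xor odd (countF (λ d → P d ∧ a (π d)))
    ≡⟨ cong (λ z → odd (countF (λ d → P d ∧ a d)) xor odd z) shifted ⟩
  odd (countF (λ d → P d ∧ a d)) xor odd (countF (λ d → P d ∧ a d))
    ≡⟨ 𝔹.xor-same (odd (countF (λ d → P d ∧ a d))) ⟩
  false ∎
  where
  open ≡-Reasoning
  shifted : countF (λ d → P d ∧ a (π d)) ≡ countF (λ d → P d ∧ a d)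
  shifted = trans (countF-cong (λ d → cong (_∧ a (π d)) (sym (Pπ d))))
                  (countF-permute π π⁻ ππ⁻ π⁻π (λ d → P d ∧ a d))

countF-three : ∀ {m} (e₀ e₁ e₂ : Fin m) → Distinct3 e₀ e₁ e₂ → (g : Fin m → Bool) →
  countF (λ d → ((d ==ᶠ e₀) ∨ ((d ==ᶠ e₁) ∨ (d ==ᶠ e₂))) ∧ g d) ≡ ind (g e₀) + (ind (g e₁) + ind (g e₂))
countF-three {m} e₀ e₁ e₂ (e₀≢e₁ , e₁≢e₂ , e₀≢e₂) g = begin
  countF (λ d → ((d ==ᶠ e₀) ∨ ((d ==ᶠ e₁) ∨ (d ==ᶠ e₂))) ∧ g d)
    ≡⟨ countF-cong distribute ⟩
  countF (λ d → at e₀ d ∨ (at e₁ d ∨ at e₂ d))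
    ≡⟨ countF-∨ (at e₀) _ (λ d → trans (𝔹.∧-distribˡ-∨ (at e₀ d) (at e₁ d) (at e₂ d))
                                        (cong₂ _∨_ (apart e₀≢e₁ d) (apart e₀≢e₂ d))) ⟩
  countF (at e₀) + countF (λ d → at e₁ d ∨ at e₂ d)
    ≡⟨ cong (countF (at e₀) +_) (countF-∨ (at e₁) (at e₂) (apart e₁≢e₂)) ⟩
  countF (at e₀) + (countF (at e₁) + countF (at e₂))
    ≡⟨ cong₂ _+_ (countF-single e₀ g) (cong₂ _+_ (countF-single e₁ g) (countF-single e₂ g)) ⟩
  ind (g e₀) + (ind (g e₁) + ind (g e₂)) ∎
  where
  open ≡-Reasoning
  at : Fin m → Fin m → Bool
  at e d = (d ==ᶠ e) ∧ g d
  distribute : ∀ d → ((d ==ᶠ e₀) ∨ ((d ==ᶠ e₁) ∨ (d ==ᶠ e₂))) ∧ g d ≡ at e₀ d ∨ (at e₁ d ∨ at e₂ d)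
  distribute d = trans (𝔹.∧-distribʳ-∨ (g d) (d ==ᶠ e₀) _)
                       (cong (at e₀ d ∨_) (𝔹.∧-distribʳ-∨ (g d) (d ==ᶠ e₁) (d ==ᶠ e₂)))
  apart : ∀ {e e′} → e ≢ e′ → ∀ d → at e d ∧ at e′ d ≡ false
  apart {e} {e′} e≢e′ d with d ==ᶠ e in de
  ... | false = refl
  ... | true  = trans (cong (λ z → g d ∧ (z ∧ g d)) (≢⇒==ᶠ (λ q → e≢e′ (trans (sym (==ᶠ⇒≡ de)) q))))
                      (𝔹.∧-zeroʳ (g d))

anyF : ∀ {m} → (Fin m → Bool) → Bool
anyF {zero}  p = false
anyF {suc m} p = p fzero ∨ anyF (λ i → p (fsuc i))

anyF-intro : ∀ {m} (p : Fin m → Bool) i → p i ≡ true → anyF p ≡ true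
anyF-intro p fzero    e = ∨-introˡ (p fzero) _ e
anyF-intro p (fsuc i) e = ∨-introʳ (p fzero) _ (anyF-intro (λ j → p (fsuc j)) i e)

anyF-elim : ∀ {m} (p : Fin m → Bool) → anyF p ≡ true → ∃ λ i → p i ≡ true
anyF-elim {suc m} p e with ∨-elim (p fzero) _ e
... | inj₁ e₀ = fzero , e₀
... | inj₂ e₁ with anyF-elim (λ i → p (fsuc i)) e₁
... | i , eᵢ = fsuc i , eᵢ

anyF-false : ∀ {m} (p : Fin m → Bool) → anyF p ≡ false → ∀ i → p i ≡ false
anyF-false p e i with true⊎false (p i)
... | inj₁ q = ⊥-elim (true≢false (trans (sym (anyF-intro p i q)) e))
... | inj₂ q = q

anyF-none : ∀ {m} (p : Fin m → Bool) → (∀ i → p i ≡ false) → anyF p ≡ false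
anyF-none p none with true⊎false (anyF p)
... | inj₂ q = q
... | inj₁ q with anyF-elim p q
... | i , e = ⊥-elim (true≢false (trans (sym e) (none i)))

search : ∀ {m} (p : Fin m → Bool) → (∃ λ i → p i ≡ true) ⊎ (∀ i → p i ≡ false)
search p with true⊎false (anyF p)
... | inj₁ e = inj₁ (anyF-elim p e)
... | inj₂ e = inj₂ (anyF-false p e)

module Optimum {_≼_ : ℕ → ℕ → Set} (≼-refl : ∀ {a} → a ≼ a)
  (≼-trans : ∀ {a b c} → a ≼ b → b ≼ c → a ≼ c) (≼-total : ∀ a b → a ≼ b ⊎ b ≼ a) where

  Optimal : ∀ {m} → (Fin m → Bool) → (Fin m → ℕ) → Fin m → Set
  Optimal p w d = p d ≡ true × (∀ e → p e ≡ true → w d ≼ w e)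

  optimum : ∀ {m} (p : Fin m → Bool) (w : Fin m → ℕ) → (∃ (Optimal p w)) ⊎ (∀ e → p e ≡ false)
  optimum {zero}  p w = inj₂ (λ ())
  optimum {suc m} p w with optimum (λ i → p (fsuc i)) (λ i → w (fsuc i)) | true⊎false (p fzero)
  ... | inj₂ none | inj₂ q = inj₂ λ { fzero → q ; (fsuc e) → none e }
  ... | inj₂ none | inj₁ q =
    inj₁ (fzero , q , λ { fzero _ → ≼-refl ; (fsuc e) pe → ⊥-elim (true≢false (trans (sym pe) (none e))) })
  ... | inj₁ (d , pd , opt) | inj₂ q =
    inj₁ (fsuc d , pd , λ { fzero pe → ⊥-elim (true≢false (trans (sym pe) q)) ; (fsuc e) pe → opt e pe })
  ... | inj₁ (d , pd , opt) | inj₁ q with ≼-total (w fzero) (w (fsuc d))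
  ...   | inj₁ le = inj₁ (fzero , q , λ { fzero _ → ≼-refl ; (fsuc e) pe → ≼-trans le (opt e pe) })
  ...   | inj₂ ge = inj₁ (fsuc d , pd , λ { fzero _ → ge ; (fsuc e) pe → opt e pe })

  optimum-of : ∀ {m} (p : Fin m → Bool) (w : Fin m → ℕ) i → p i ≡ true → ∃ (Optimal p w)
  optimum-of p w i pi with optimum p w
  ... | inj₁ o    = o
  ... | inj₂ none = ⊥-elim (true≢false (trans (sym pi) (none i)))

open Optimum ≤-refl ≤-trans ≤-total using () renaming (Optimal to Minimal; optimum-of to argmin-of)
open Optimum {λ a b → b ≤ a} ≤-refl (λ p q → ≤-trans q p) (λ a b → ≤-total b a)
  using () renaming (Optimal to Maximal; optimum-of to argmax-of)

-- the least k ≤ K with p k, and K if there is none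
least : (ℕ → Bool) → ℕ → ℕ
least p zero    = 0
least p (suc K) = if p 0 then 0 else suc (least (λ k → p (suc k)) K)

least-sound : ∀ (p : ℕ → Bool) K k → k ≤ K → p k ≡ true → p (least p K) ≡ true
least-sound p zero    zero    _ e = e
least-sound p (suc K) k       le e with p 0 in p0
... | true  = p0
least-sound p (suc K) zero    le e | false = ⊥-elim (true≢false (trans (sym e) p0))
least-sound p (suc K) (suc k) le e | false = least-sound (λ j → p (suc j)) K k (≤-pred le) e

least-minimal : ∀ (p : ℕ → Bool) K k → k < least p K → p k ≡ false
least-minimal p (suc K) k lt with p 0 in p0
least-minimal p (suc K) k       () | true
least-minimal p (suc K) zero    lt | false = p0
least-minimal p (suc K) (suc k) lt | false = least-minimal (λ j → p (suc j)) K k (≤-pred lt)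

least-≤-bound : ∀ (p : ℕ → Bool) K → least p K ≤ K
least-≤-bound p zero    = z≤n
least-≤-bound p (suc K) with p 0
... | true  = z≤n
... | false = s≤s (least-≤-bound (λ k → p (suc k)) K)

least-≤ : ∀ (p : ℕ → Bool) K k → p k ≡ true → least p K ≤ k
least-≤ p K k e with least p K ≤? k
... | yes le = le
... | no  gt = ⊥-elim (true≢false (trans (sym e) (least-minimal p K k (≰⇒> gt))))

-- Four colours as pairs of bits, RGB as the nonzero vectors of 𝔽₂²

lowBit highBit : Fin 4 → Bool
lowBit  i = odd (toℕ i)
highBit i = 2 ≤ᵇ toℕ i

fromBits : Bool → Bool → Fin 4
fromBits false false = fzero
fromBits true  false = fsuc fzero
fromBits false true  = fsuc (fsuc fzero)
fromBits true  true  = fsuc (fsuc (fsuc fzero))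

fromBits-bits : ∀ i → fromBits (lowBit i) (highBit i) ≡ i
fromBits-bits fzero                      = refl
fromBits-bits (fsuc fzero)               = refl
fromBits-bits (fsuc (fsuc fzero))        = refl
fromBits-bits (fsuc (fsuc (fsuc fzero))) = refl

bits-fromBits : ∀ a b → lowBit (fromBits a b) ≡ a × highBit (fromBits a b) ≡ b
bits-fromBits false false = refl , refl
bits-fromBits true  false = refl , refl
bits-fromBits false true  = refl , refl
bits-fromBits true  true  = refl , refl

fromBits-injective : ∀ {a b a′ b′} → fromBits a b ≡ fromBits a′ b′ → a ≡ a′ × b ≡ b′
fromBits-injective {a} {b} {a′} {b′} e =
  trans (sym (proj₁ (bits-fromBits a b))) (trans (cong lowBit e) (proj₁ (bits-fromBits a′ b′))) ,
  trans (sym (proj₂ (bits-fromBits a b))) (trans (cong highBit e) (proj₂ (bits-fromBits a′ b′)))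

bits-injective : ∀ {i j} → lowBit i ≡ lowBit j → highBit i ≡ highBit j → i ≡ j
bits-injective {i} {j} p q = trans (sym (fromBits-bits i)) (trans (cong₂ fromBits p q) (fromBits-bits j))

bit₁ bit₂ : RGB → Bool
bit₁ red   = true
bit₁ green = false
bit₁ blue  = true
bit₂ red   = false
bit₂ green = true
bit₂ blue  = true

-- (false, false) is sent to the junk value red
rgb : Bool → Bool → RGB
rgb true  false = red
rgb false true  = green
rgb true  true  = blue
rgb false false = red

rgb-bits : ∀ a b → ¬ (a ≡ false × b ≡ false) → bit₁ (rgb a b) ≡ a × bit₂ (rgb a b) ≡ b
rgb-bits true  false _  = refl , refl
rgb-bits false true  _  = refl , refl
rgb-bits true  true  _  = refl , refl
rgb-bits false false nz = ⊥-elim (nz (refl , refl))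

bits-nonzero : ∀ c → ¬ (bit₁ c ≡ false × bit₂ c ≡ false)
bits-nonzero red   (() , _)
bits-nonzero green (_ , ())
bits-nonzero blue  (() , _)

_≟ᶜ_ : DecidableEquality RGB
red   ≟ᶜ red   = yes refl
green ≟ᶜ green = yes refl
blue  ≟ᶜ blue  = yes refl
red   ≟ᶜ green = no λ ()
red   ≟ᶜ blue  = no λ ()
green ≟ᶜ red   = no λ ()
green ≟ᶜ blue  = no λ ()
blue  ≟ᶜ red   = no λ ()
blue  ≟ᶜ green = no λ ()

allRGB? : {P : RGB → Set} → (∀ c → Dec (P c)) → Dec (∀ c → P c)
allRGB? P? with P? red | P? green | P? blue
... | yes r | yes g | yes b = yes λ { red → r ; green → g ; blue → b }
... | no ¬r | _     | _     = no λ all → ¬r (all red)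
... | yes _ | no ¬g | _     = no λ all → ¬g (all green)
... | yes _ | yes _ | no ¬b = no λ all → ¬b (all blue)

distinct3? : {A : Set} → DecidableEquality A → ∀ (x y z : A) → Dec (Distinct3 x y z)
distinct3? _≟_ x y z = ¬? (x ≟ y) ×-dec (¬? (y ≟ z) ×-dec ¬? (x ≟ z))

distinct-colours-sum-even : ∀ x y z → Distinct3 x y z →
  odd (ind (bit₁ x) + (ind (bit₁ y) + ind (bit₁ z))) ≡ false ×
  odd (ind (bit₂ x) + (ind (bit₂ y) + ind (bit₂ z))) ≡ false
distinct-colours-sum-even = from-yes
  (allRGB? λ x → allRGB? λ y → allRGB? λ z → distinct3? _≟ᶜ_ x y z →-dec
     ((𝔹._≟_ (odd (ind (bit₁ x) + (ind (bit₁ y) + ind (bit₁ z)))) false) ×-dec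
      (𝔹._≟_ (odd (ind (bit₂ x) + (ind (bit₂ y) + ind (bit₂ z)))) false)))

sameLowBit : Fin 4 → Fin 4 → Bool
sameLowBit i j = not (lowBit i xor lowBit j)

distinct-sameLowBit-once : ∀ i j k → Distinct3 i j k →
  ind (sameLowBit i j) + ind (sameLowBit j k) + ind (sameLowBit k i) ≡ 1
distinct-sameLowBit-once = from-yes
  (FinP.all? λ i → FinP.all? λ j → FinP.all? λ k → distinct3? FinP._≟_ i j k →-dec
     (ind (sameLowBit i j) + ind (sameLowBit j k) + ind (sameLowBit k i) Data.Nat.≟ 1))

parities-equal-sum : ∀ r g b → r ≡ r xor (g xor b) → g ≡ r xor (g xor b) → b ≡ r xor (g xor b) →
                     r xor b ≡ false × g xor b ≡ false
parities-equal-sum true  true  true  _  _  _  = refl , refl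
parities-equal-sum false false false _  _  _  = refl , refl
parities-equal-sum true  true  false () _  _
parities-equal-sum true  false true  () _  _
parities-equal-sum true  false false _  () _
parities-equal-sum false true  true  _  () _
parities-equal-sum false true  false () _  _
parities-equal-sum false false true  () _  _

parities-equal : ∀ r g b → r xor b ≡ false → g xor b ≡ false →
                 r ≡ r xor (g xor b) × g ≡ r xor (g xor b) × b ≡ r xor (g xor b)
parities-equal true  true  true  _  _  = refl , refl , refl
parities-equal false false false _  _  = refl , refl , refl
parities-equal true  _     false () _
parities-equal false _     true  () _
parities-equal true  false true  _  ()
parities-equal false true  false _  ()

module ColourCounts {k : ℕ} (P : Fin k → Bool) (col : Fin k → RGB) where

  oddCount : (RGB → Bool) → Bool
  oddCount f = odd (countF (λ i → P i ∧ f (col i)))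

  oddCount-xor : ∀ f g → oddCount (λ c → f c xor g c) ≡ oddCount f xor oddCount g
  oddCount-xor f g = odd-countF-∧-xor P (λ i → f (col i)) (λ i → g (col i))

  oddCount-cong : ∀ {f g} → (∀ c → f c ≡ g c) → oddCount f ≡ oddCount g
  oddCount-cong e = cong odd (countF-cong (λ i → cong (P _ ∧_) (e (col i))))

  oddRed oddGreen oddBlue : Bool
  oddRed   = oddCount (_==c red)
  oddGreen = oddCount (_==c green)
  oddBlue  = oddCount (_==c blue)

  oddSum : Bool
  oddSum = oddRed xor (oddGreen xor oddBlue)

  oddCount-total : odd (countF P) ≡ oddSum
  oddCount-total = begin
    odd (countF P)
      ≡⟨ cong odd (countF-cong (λ i → sym (𝔹.∧-identityʳ (P i)))) ⟩
    oddCount (λ _ → true)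
      ≡⟨ oddCount-cong split ⟩
    oddCount (λ c → (c ==c red) xor ((c ==c green) xor (c ==c blue)))
      ≡⟨ oddCount-xor (_==c red) (λ c → (c ==c green) xor (c ==c blue)) ⟩
    oddRed xor oddCount (λ c → (c ==c green) xor (c ==c blue))
      ≡⟨ cong (oddRed xor_) (oddCount-xor (_==c green) (_==c blue)) ⟩
    oddRed xor (oddGreen xor oddBlue) ∎
    where
    open ≡-Reasoning
    split : ∀ c → true ≡ (c ==c red) xor ((c ==c green) xor (c ==c blue))
    split red   = refl
    split green = refl
    split blue  = refl

  oddCount-bit₁ : oddCount bit₁ ≡ oddRed xor oddBlue
  oddCount-bit₁ = trans (oddCount-cong split) (oddCount-xor (_==c red) (_==c blue))
    where
    split : ∀ c → bit₁ c ≡ (c ==c red) xor (c ==c blue)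
    split red   = refl
    split green = refl
    split blue  = refl

  oddCount-bit₂ : oddCount bit₂ ≡ oddGreen xor oddBlue
  oddCount-bit₂ = trans (oddCount-cong split) (oddCount-xor (_==c green) (_==c blue))
    where
    split : ∀ c → bit₂ c ≡ (c ==c green) xor (c ==c blue)
    split red   = refl
    split green = refl
    split blue  = refl

  ColourParities BitsEven : Set
  ColourParities = ∀ c → countF (λ i → P i ∧ (col i ==c c)) % 2 ≡ countF P % 2
  BitsEven = oddCount bit₁ ≡ false × oddCount bit₂ ≡ false

  colourParities⇒bitsEven : ColourParities → BitsEven
  colourParities⇒bitsEven par = trans oddCount-bit₁ (proj₁ sums) , trans oddCount-bit₂ (proj₂ sums)
    where
    same : ∀ c → oddCount (_==c c) ≡ oddSum
    same c = trans (%2≡⇒odd≡ (countF (λ i → P i ∧ (col i ==c c))) (countF P) (par c)) oddCount-total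
    sums : oddRed xor oddBlue ≡ false × oddGreen xor oddBlue ≡ false
    sums = parities-equal-sum oddRed oddGreen oddBlue (same red) (same green) (same blue)

  bitsEven⇒colourParities : BitsEven → ColourParities
  bitsEven⇒colourParities (even₁ , even₂) c =
    odd≡⇒%2≡ (countF (λ i → P i ∧ (col i ==c c))) (countF P) (trans (same c) (sym oddCount-total))
    where
    eqs : oddRed ≡ oddSum × oddGreen ≡ oddSum × oddBlue ≡ oddSum
    eqs = parities-equal oddRed oddGreen oddBlue (trans (sym oddCount-bit₁) even₁) (trans (sym oddCount-bit₂) even₂)
    same : ∀ c → oddCount (_==c c) ≡ oddSum
    same red   = proj₁ eqs
    same green = proj₁ (proj₂ eqs)
    same blue  = proj₂ (proj₂ eqs)

module _ {n : ℕ} (P : ℕ → Fin n → Bool) (mono : ∀ k → P k ⊆ᵇ P (suc k))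
  (stable : ∀ k → P (suc k) ⊆ᵇ P k → P (suc (suc k)) ⊆ᵇ P (suc k)) where

  private
    mono-≤ : ∀ {k k′} → k ≤ k′ → P k ⊆ᵇ P k′
    mono-≤ {k} {k′} le x e = subst (λ z → P z x ≡ true) (m∸n+n≡m le) (go (k′ ∸ k))
      where
      go : ∀ i → P (i + k) x ≡ true
      go zero    = e
      go (suc i) = mono (i + k) x (go i)

    stays : ∀ j → P (suc j) ⊆ᵇ P j → ∀ i → P (i + j) ⊆ᵇ P j
    stays j s = go
      where
      step-down : ∀ i → P (suc (i + j)) ⊆ᵇ P (i + j)
      step-down zero    = s
      step-down (suc i) = stable (i + j) (step-down i)
      go : ∀ i → P (i + j) ⊆ᵇ P j
      go zero    x e = e
      go (suc i) x e = go i x (step-down i x e)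

    grows : ∀ k → (∃ λ j → j < k × P (suc j) ⊆ᵇ P j) ⊎ (k ≤ countF (P k))
    grows zero = inj₂ z≤n
    grows (suc k) with grows k
    ... | inj₁ (j , j<k , s) = inj₁ (j , m≤n⇒m≤1+n j<k , s)
    ... | inj₂ c with search (λ x → P (suc k) x ∧ not (P k x))
    ...   | inj₁ (x , new) = inj₂ (≤-trans (s≤s c)
            (countF-mono-< (mono k) x (∧-elimˡ _ _ new) (𝔹.not-injective (∧-elimʳ (P (suc k) x) _ new))))
    ...   | inj₂ none = inj₁ (k , ≤-refl , λ x e → old (none x) e)
      where
      old : ∀ {a b} → a ∧ not b ≡ false → a ≡ true → b ≡ true
      old {b = true}  _  _    = refl
      old {b = false} () refl

  chain-stabilises : ∀ k → P k ⊆ᵇ P (suc n)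
  chain-stabilises k x e with grows (suc n)
  ... | inj₂ c = ⊥-elim (<-irrefl refl (<-≤-trans c (countF-≤ (P (suc n)))))
  ... | inj₁ (j , j<sn , s) = mono-≤ (<⇒≤ j<sn) x (stays j s k x (mono-≤ (m≤m+n k j) x e))

-- A graph given by its darts: h d is the tail of dart d and α d its reverse; the
-- α-invariant set X of darts selects the subgraph in which walks run.

module DartGraph {n m : ℕ} (α : Fin m → Fin m) (α-invol : ∀ d → α (α d) ≡ d)
  (h : Fin m → Fin n) (X : Fin m → Bool) (X-α : ∀ d → X (α d) ≡ X d) where

  data Walk : Fin n → Fin n → List (Fin m) → Set where
    []   : ∀ {u} → Walk u u []
    step : ∀ {u v d ds} → X d ≡ true → h d ≡ u → Walk (h (α d)) v ds → Walk u v (d ∷ ds)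

  castˡ : ∀ {u u′ v ds} → u ≡ u′ → Walk u v ds → Walk u′ v ds
  castˡ refl w = w

  castʳ : ∀ {u v v′ ds} → v ≡ v′ → Walk u v ds → Walk u v′ ds
  castʳ refl w = w

  _++ʷ_ : ∀ {u v w xs ys} → Walk u v xs → Walk v w ys → Walk u w (xs ++ ys)
  []            ++ʷ q = q
  step x e p    ++ʷ q = step x e (p ++ʷ q)

  reverseDarts : List (Fin m) → List (Fin m)
  reverseDarts []       = []
  reverseDarts (d ∷ ds) = reverseDarts ds ++ (α d ∷ [])

  reverseʷ : ∀ {u v ds} → Walk u v ds → Walk v u (reverseDarts ds)
  reverseʷ []                   = []
  reverseʷ (step {d = d} x e p) =
    reverseʷ p ++ʷ step (trans (X-α d) x) refl (castˡ (sym (trans (cong h (α-invol d)) e)) [])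

  walk-start : ∀ {u v d ds} → Walk u v (d ∷ ds) → h d ≡ u
  walk-start (step _ e _) = e

  walk-empty : ∀ {u v} → Walk u v [] → u ≡ v
  walk-empty [] = refl

  walk-split : ∀ xs {ys u v} → Walk u v (xs ++ ys) → ∃ λ z → Walk u z xs × Walk z v ys
  walk-split []       w            = _ , [] , w
  walk-split (x ∷ xs) (step i e w) with walk-split xs w
  ... | z , w₁ , w₂ = z , step i e w₁ , w₂

  xorAlong : (Fin m → Bool) → List (Fin m) → Bool
  xorAlong b []       = false
  xorAlong b (d ∷ ds) = b d xor xorAlong b ds

  xorAlong-++ : ∀ b xs ys → xorAlong b (xs ++ ys) ≡ xorAlong b xs xor xorAlong b ys
  xorAlong-++ b []       ys = refl
  xorAlong-++ b (x ∷ xs) ys = trans (cong (b x xor_) (xorAlong-++ b xs ys)) (sym (𝔹.xor-assoc (b x) _ _))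

  xorAlong-reverse : ∀ b → (∀ d → b (α d) ≡ b d) → ∀ ds → xorAlong b (reverseDarts ds) ≡ xorAlong b ds
  xorAlong-reverse b bα []       = refl
  xorAlong-reverse b bα (d ∷ ds) = begin
    xorAlong b (reverseDarts ds ++ (α d ∷ []))
      ≡⟨ xorAlong-++ b (reverseDarts ds) (α d ∷ []) ⟩
    xorAlong b (reverseDarts ds) xor (b (α d) xor false)
      ≡⟨ cong₂ _xor_ (xorAlong-reverse b bα ds) (trans (𝔹.xor-identityʳ (b (α d))) (bα d)) ⟩
    xorAlong b ds xor b d
      ≡⟨ 𝔹.xor-comm (xorAlong b ds) (b d) ⟩
    b d xor xorAlong b ds ∎
    where open ≡-Reasoning

  -- Breadth-first search: Within k s x iff x reaches s in at most k steps.

  StepInto : (Fin n → Bool) → Fin n → Fin m → Bool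
  StepInto P x d = X d ∧ ((h d ==ᶠ x) ∧ P (h (α d)))

  StepInto-elim : ∀ P x d → StepInto P x d ≡ true → X d ≡ true × h d ≡ x × P (h (α d)) ≡ true
  StepInto-elim P x d e with X d | h d ==ᶠ x in hx | P (h (α d))
  ... | true | true | true = refl , ==ᶠ⇒≡ hx , refl

  StepInto-intro : ∀ P x d → X d ≡ true → h d ≡ x → P (h (α d)) ≡ true → StepInto P x d ≡ true
  StepInto-intro P x d xd hd p = ∧-intro xd (∧-intro (≡⇒==ᶠ hd) p)

  Within : ℕ → Fin n → Fin n → Bool
  Within zero    s x = x ==ᶠ s
  Within (suc k) s x = Within k s x ∨ anyF (StepInto (Within k s) x)

  Within-suc : ∀ k s x → Within k s x ≡ true → Within (suc k) s x ≡ true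
  Within-suc k s x = ∨-introˡ _ _

  Within⇒Walk : ∀ k s x → Within k s x ≡ true → ∃ λ ds → Walk x s ds
  Within⇒Walk zero    s x e = [] , castˡ (sym (==ᶠ⇒≡ e)) []
  Within⇒Walk (suc k) s x e with ∨-elim (Within k s x) _ e
  ... | inj₁ q = Within⇒Walk k s x q
  ... | inj₂ q with anyF-elim (StepInto (Within k s) x) q
  ... | d , r with StepInto-elim (Within k s) x d r
  ... | xd , hd , next with Within⇒Walk k s (h (α d)) next
  ... | ds , w = d ∷ ds , step xd hd w

  Walk⇒Within : ∀ {x s ds} → Walk x s ds → Within (length ds) s x ≡ true
  Walk⇒Within {x} []                                = ==ᶠ-refl x
  Walk⇒Within {x} {s} (step {d = d} {ds = ds} xd hd w) =
    ∨-introʳ _ _ (anyF-intro (StepInto (Within (length ds) s) x) d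
                   (StepInto-intro (Within (length ds) s) x d xd hd (Walk⇒Within w)))

  Within-stable : ∀ s k → Within (suc k) s ⊆ᵇ Within k s → Within (suc (suc k)) s ⊆ᵇ Within (suc k) s
  Within-stable s k sub x e with ∨-elim (Within (suc k) s x) _ e
  ... | inj₁ q = q
  ... | inj₂ q with anyF-elim (StepInto (Within (suc k) s) x) q
  ... | d , r with StepInto-elim (Within (suc k) s) x d r
  ... | xd , hd , next = ∨-introʳ _ _ (anyF-intro (StepInto (Within k s) x) d
                                         (StepInto-intro (Within k s) x d xd hd (sub (h (α d)) next)))

  Connected : Fin n → Fin n → Bool
  Connected s x = Within (suc n) s x

  Walk⇒Connected : ∀ {x s ds} → Walk x s ds → Connected s x ≡ true
  Walk⇒Connected {x} {s} {ds} w =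
    chain-stabilises (λ k → Within k s) (λ k → Within-suc k s) (Within-stable s) (length ds) x (Walk⇒Within w)

  Connected⇒Walk : ∀ {s x} → Connected s x ≡ true → ∃ λ ds → Walk x s ds
  Connected⇒Walk {s} {x} = Within⇒Walk (suc n) s x

  Connected-refl : ∀ x → Connected x x ≡ true
  Connected-refl x = Walk⇒Connected []

  Connected-back : ∀ {s} d → X d ≡ true → Connected s (h (α d)) ≡ true → Connected s (h d) ≡ true
  Connected-back d xd c = Walk⇒Connected (step xd refl (proj₂ (Connected⇒Walk c)))

  Connected-forth : ∀ {s} d → X d ≡ true → Connected s (h d) ≡ true → Connected s (h (α d)) ≡ true
  Connected-forth {s} d xd c =
    Connected-back (α d) (trans (X-α d) xd) (subst (λ z → Connected s (h z) ≡ true) (sym (α-invol d)) c)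

  δ : (Fin n → Bool) → Fin m → Bool
  δ g d = g (h d) xor g (h (α d))

  δ-α : ∀ g d → δ g (α d) ≡ δ g d
  δ-α g d = trans (cong (λ z → g (h (α d)) xor g (h z)) (α-invol d)) (𝔹.xor-comm (g (h (α d))) (g (h d)))

  Potential : (Fin m → Bool) → (Fin m → Bool) → Set
  Potential S b = ∃ λ g → ∀ d → S d ≡ true → δ g d ≡ b d

  -- Take the xor along a walk to the least vertex of the component as the potential.
  closedWalksEven⇒potential : (b : Fin m → Bool) → (∀ d → b (α d) ≡ b d) →
    (∀ {u ds} → Walk u u ds → xorAlong b ds ≡ false) → Potential X b
  closedWalksEven⇒potential b bα closed-even = potential , potential-δ
    where
    path-independent : ∀ {x s ds es} → Walk x s ds → Walk x s es → xorAlong b ds ≡ xorAlong b es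
    path-independent {ds = ds} {es} w w′ = xor≡false⇒≡ _ _ (begin
      xorAlong b ds xor xorAlong b es                   ≡⟨ cong (xorAlong b ds xor_) (sym (xorAlong-reverse b bα es)) ⟩
      xorAlong b ds xor xorAlong b (reverseDarts es)    ≡⟨ sym (xorAlong-++ b ds (reverseDarts es)) ⟩
      xorAlong b (ds ++ reverseDarts es)                ≡⟨ closed-even (w ++ʷ reverseʷ w′) ⟩
      false                                             ∎)
      where open ≡-Reasoning

    base : (x : Fin n) → ∃ (Minimal (λ s → Connected s x) toℕ)
    base x = argmin-of (λ s → Connected s x) toℕ x (Connected-refl x)

    base-cong : ∀ x y → (∀ s → Connected s x ≡ true → Connected s y ≡ true) →
                (∀ s → Connected s y ≡ true → Connected s x ≡ true) → proj₁ (base x) ≡ proj₁ (base y)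
    base-cong x y f g with base x | base y
    ... | s , cs , ms | t , ct , mt = FinP.toℕ-injective (≤-antisym (ms t (g t ct)) (mt s (f s cs)))

    walkToBase : (x : Fin n) → ∃ λ ds → Walk x (proj₁ (base x)) ds
    walkToBase x = Connected⇒Walk (proj₁ (proj₂ (base x)))

    potential : Fin n → Bool
    potential x = xorAlong b (proj₁ (walkToBase x))

    potential-δ : ∀ d → X d ≡ true → δ potential d ≡ b d
    potential-δ d xd = begin
      potential (h d) xor potential (h (α d))
        ≡⟨ cong (_xor potential (h (α d))) (sym (path-independent extended (proj₂ (walkToBase (h d))))) ⟩
      (b d xor potential (h (α d))) xor potential (h (α d))
        ≡⟨ xor-xor-cancelʳ (b d) _ ⟩
      b d ∎
      where
      open ≡-Reasoning
      same-base : proj₁ (base (h (α d))) ≡ proj₁ (base (h d))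
      same-base = base-cong (h (α d)) (h d) (λ _ → Connected-back d xd) (λ _ → Connected-forth d xd)
      extended : Walk (h d) (proj₁ (base (h d))) (d ∷ proj₁ (walkToBase (h (α d))))
      extended = step xd refl (castʳ same-base (proj₂ (walkToBase (h (α d)))))

  -- A breadth-first spanning tree of the vertices act, which are connected to the root r:
  -- the parent dart of a vertex x ≠ r is the least dart from x to a vertex one level closer to r.
  module SpanningTree (act : Fin n → Bool) (act-h : ∀ d → act (h d) ≡ true)
    (r : Fin n) (act-r : act r ≡ true) (act⇒Connected : ∀ x → act x ≡ true → Connected r x ≡ true) where

    depth : Fin n → ℕ
    depth x = least (λ k → Within k r x) (suc n)

    depth-Within : ∀ x → act x ≡ true → Within (depth x) r x ≡ true
    depth-Within x ax = least-sound (λ k → Within k r x) (suc n) (suc n) ≤-refl (act⇒Connected x ax)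

    depth-minimal : ∀ x k → k < depth x → Within k r x ≡ false
    depth-minimal x = least-minimal (λ k → Within k r x) (suc n)

    depth-≤ : ∀ x k → Within k r x ≡ true → depth x ≤ k
    depth-≤ x = least-≤ (λ k → Within k r x) (suc n)

    depth-≤-bound : ∀ x → depth x ≤ suc n
    depth-≤-bound x = least-≤-bound (λ k → Within k r x) (suc n)

    depth-pos : ∀ x → act x ≡ true → x ≢ r → 1 ≤ depth x
    depth-pos x ax x≢r with depth x in eq
    ... | suc _ = s≤s z≤n
    ... | zero  = ⊥-elim (x≢r (==ᶠ⇒≡ (subst (λ k → Within k r x ≡ true) eq (depth-Within x ax))))

    Descends : Fin n → Fin m → Bool
    Descends x = StepInto (Within (depth x ∸ 1) r) x

    EarlierDescent : Fin m → Fin m → Bool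
    EarlierDescent d d′ = (toℕ d′ Data.Nat.<ᵇ toℕ d) ∧ Descends (h d) d′

    IsParent : Fin m → Bool
    IsParent d = not (h d ==ᶠ r) ∧ (Descends (h d) d ∧ not (anyF (EarlierDescent d)))

    InTree : Fin m → Bool
    InTree d = IsParent d ∨ IsParent (α d)

    IsParent-elim : ∀ d → IsParent d ≡ true →
      h d ≢ r × Descends (h d) d ≡ true × (∀ d′ → toℕ d′ < toℕ d → Descends (h d) d′ ≡ false)
    IsParent-elim d e =
      (λ q → true≢false (trans (sym (≡⇒==ᶠ q)) (𝔹.not-injective notRoot))) , desc ,
      λ d′ lt → later (anyF-false (EarlierDescent d) (𝔹.not-injective noEarlier) d′) (T⇒≡true (<⇒<ᵇ lt))
      where
      notRoot : not (h d ==ᶠ r) ≡ true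
      notRoot = ∧-elimˡ (not (h d ==ᶠ r)) _ e
      rest : Descends (h d) d ∧ not (anyF (EarlierDescent d)) ≡ true
      rest = ∧-elimʳ (not (h d ==ᶠ r)) _ e
      desc : Descends (h d) d ≡ true
      desc = ∧-elimˡ (Descends (h d) d) _ rest
      noEarlier : not (anyF (EarlierDescent d)) ≡ true
      noEarlier = ∧-elimʳ (Descends (h d) d) _ rest
      later : ∀ {a c} → a ∧ c ≡ false → a ≡ true → c ≡ false
      later e refl = e

    IsParent-intro : ∀ d → h d ≢ r → Descends (h d) d ≡ true →
                     (∀ d′ → toℕ d′ < toℕ d → Descends (h d) d′ ≡ false) → IsParent d ≡ true
    IsParent-intro d hd≢r desc least-d =
      ∧-intro (cong not (≢⇒==ᶠ hd≢r)) (∧-intro desc (cong not (anyF-none (EarlierDescent d) none)))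
      where
      none : ∀ d′ → EarlierDescent d d′ ≡ false
      none d′ with toℕ d′ Data.Nat.<ᵇ toℕ d in lt
      ... | true  = least-d d′ (<ᵇ⇒< (toℕ d′) (toℕ d) (≡true⇒T lt))
      ... | false = refl

    IsParent⇒X : ∀ d → IsParent d ≡ true → X d ≡ true
    IsParent⇒X d e = proj₁ (StepInto-elim (Within (depth (h d) ∸ 1) r) (h d) d (proj₁ (proj₂ (IsParent-elim d e))))

    IsParent-depth : ∀ d → IsParent d ≡ true → depth (h (α d)) < depth (h d)
    IsParent-depth d e with IsParent-elim d e
    ... | hd≢r , desc , _ with StepInto-elim (Within (depth (h d) ∸ 1) r) (h d) d desc
    ... | _ , _ , within = ≤-trans (s≤s (depth-≤ (h (α d)) _ within))
          (≤-reflexive (trans (+-comm 1 (depth (h d) ∸ 1)) (m∸n+n≡m (depth-pos (h d) (act-h d) hd≢r))))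

    IsParent-unique : ∀ d d′ → IsParent d ≡ true → IsParent d′ ≡ true → h d ≡ h d′ → d ≡ d′
    IsParent-unique d d′ e e′ eq with IsParent-elim d e | IsParent-elim d′ e′ | <-cmp (toℕ d) (toℕ d′)
    ... | _ | _ | tri≈ _ q _ = FinP.toℕ-injective q
    ... | _ , desc , _ | _ , _ , least′ | tri< lt _ _ =
      ⊥-elim (true≢false (trans (sym desc) (subst (λ z → Descends z d ≡ false) (sym eq) (least′ d lt))))
    ... | _ , _ , least | _ , desc′ , _ | tri> _ _ gt =
      ⊥-elim (true≢false (trans (sym desc′) (subst (λ z → Descends z d′ ≡ false) eq (least d′ gt))))

    parent-exists : ∀ x → act x ≡ true → x ≢ r → ∃ λ d → IsParent d ≡ true × h d ≡ x
    parent-exists x ax x≢r = d , IsParent-intro d (λ q → x≢r (trans (sym hd) q)) desc′ least′ , hd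
      where
      j : ℕ
      j = depth x ∸ 1
      depth≡ : depth x ≡ suc j
      depth≡ = trans (sym (m∸n+n≡m (depth-pos x ax x≢r))) (+-comm j 1)
      some-descent : anyF (StepInto (Within j r) x) ≡ true
      some-descent with Within j r x in wj | subst (λ k → Within k r x ≡ true) depth≡ (depth-Within x ax)
      ... | true  | _  = ⊥-elim (true≢false (trans (sym wj) (depth-minimal x j (≤-reflexive (sym depth≡)))))
      ... | false | ws = ws
      opt : ∃ (Minimal (Descends x) toℕ)
      opt = let (d₀ , e₀) = anyF-elim _ some-descent in argmin-of (Descends x) toℕ d₀ e₀
      d : Fin m
      d = proj₁ opt
      hd : h d ≡ x
      hd = proj₁ (proj₂ (StepInto-elim (Within (depth x ∸ 1) r) x d (proj₁ (proj₂ opt))))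
      desc′ : Descends (h d) d ≡ true
      desc′ = subst (λ z → Descends z d ≡ true) (sym hd) (proj₁ (proj₂ opt))
      least′ : ∀ d′ → toℕ d′ < toℕ d → Descends (h d) d′ ≡ false
      least′ d′ lt with true⊎false (Descends x d′)
      ... | inj₂ q = subst (λ z → Descends z d′ ≡ false) (sym hd) q
      ... | inj₁ q = ⊥-elim (<-irrefl refl (<-≤-trans lt (proj₂ (proj₂ opt) d′ q)))

    ¬IsParent-both : ∀ d → IsParent d ≡ true → IsParent (α d) ≡ true → ⊥
    ¬IsParent-both d e e′ = <-irrefl refl (<-trans (IsParent-depth d e)
      (subst (λ z → depth (h z) < depth (h (α d))) (α-invol d) (IsParent-depth (α d) e′)))

    -- every active vertex but the root has its own parent dart
    count-act≤ : countF act ≤ 1 + countF IsParent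
    count-act≤ = begin
      countF act                                                          ≡⟨ countF-∧-split act (_==ᶠ r) ⟩
      countF (λ x → act x ∧ (x ==ᶠ r)) + countF (λ x → act x ∧ not (x ==ᶠ r))
        ≡⟨ cong (_+ countF (λ x → act x ∧ not (x ==ᶠ r))) root ⟩
      1 + countF (λ x → act x ∧ not (x ==ᶠ r))                            ≤⟨ +-monoʳ-≤ 1 others ⟩
      1 + countF IsParent                                                 ∎
      where
      open ≤-Reasoning
      root : countF (λ x → act x ∧ (x ==ᶠ r)) ≡ 1
      root = trans (countF-cong (λ x → 𝔹.∧-comm (act x) (x ==ᶠ r))) (trans (countF-single r act) (cong ind act-r))
      has-parent : ∀ x → ind (act x ∧ not (x ==ᶠ r)) ≤ countF (λ d → (h d ==ᶠ x) ∧ IsParent d)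
      has-parent x with act x in ax | x ==ᶠ r in xr
      ... | false | _    = z≤n
      ... | true  | true = z≤n
      ... | true  | false with parent-exists x ax (λ q → true≢false (trans (sym (≡⇒==ᶠ q)) xr))
      ... | d , pd , hd = countF-pos (λ d → (h d ==ᶠ x) ∧ IsParent d) d (∧-intro (≡⇒==ᶠ hd) pd)
      others : countF (λ x → act x ∧ not (x ==ᶠ r)) ≤ countF IsParent
      others = begin
        countF (λ x → act x ∧ not (x ==ᶠ r))                  ≡⟨ countF≡sumF (λ x → act x ∧ not (x ==ᶠ r)) ⟩
        sumF (λ x → ind (act x ∧ not (x ==ᶠ r)))              ≤⟨ sumF-mono has-parent ⟩
        sumF (λ x → countF (λ d → (h d ==ᶠ x) ∧ IsParent d))  ≡⟨ sym (countF-fibres h IsParent) ⟩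
        countF IsParent                                        ∎

    count-InTree : 2 * countF act ≤ countF InTree + 2
    count-InTree = begin
      2 * countF act                                          ≤⟨ *-monoʳ-≤ 2 count-act≤ ⟩
      2 * (1 + countF IsParent)                               ≡⟨ double (countF IsParent) ⟩
      (countF IsParent + countF IsParent) + 2                 ≡⟨ cong (λ z → (countF IsParent + z) + 2) reversed ⟩
      (countF IsParent + countF (λ d → IsParent (α d))) + 2   ≡⟨ cong (_+ 2) (sym (countF-∨ IsParent _ disjoint)) ⟩
      countF InTree + 2                                       ∎
      where
      open ≤-Reasoning
      disjoint : ∀ d → IsParent d ∧ IsParent (α d) ≡ false
      disjoint d with IsParent d in e | IsParent (α d) in e′
      ... | false | _     = refl
      ... | true  | false = refl
      ... | true  | true  = ⊥-elim (¬IsParent-both d e e′)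
      reversed : countF IsParent ≡ countF (λ d → IsParent (α d))
      reversed = sym (countF-permute α α α-invol α-invol IsParent)
      double : ∀ c → 2 * (1 + c) ≡ (c + c) + 2
      double c = trans (cong ((1 + c) +_) (+-identityʳ (1 + c))) (trans (cong suc (+-suc c c)) (+-comm 2 (c + c)))

    -- A nonempty α-invariant set of tree darts has a vertex meeting it exactly once: the
    -- tail of its deepest parent dart.
    tree-acyclic : ∀ (Y : Fin m → Bool) → Y ⊆ᵇ InTree → (∀ d → Y (α d) ≡ Y d) →
      (∀ x → odd (countF (λ d → (h d ==ᶠ x) ∧ Y d)) ≡ false) → ∀ d → Y d ≡ false
    tree-acyclic Y Y⊆T Yα even d₀ with true⊎false (Y d₀)
    ... | inj₂ q  = q
    ... | inj₁ y₀ = ⊥-elim (true≢false (trans (sym (cong odd once)) (even (h e))))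
      where
      some : ∃ λ e → IsParent e ∧ Y e ≡ true
      some with ∨-elim (IsParent d₀) (IsParent (α d₀)) (Y⊆T d₀ y₀)
      ... | inj₁ p = d₀ , ∧-intro p y₀
      ... | inj₂ p = α d₀ , ∧-intro p (trans (Yα d₀) y₀)
      deepest : ∃ (Maximal (λ e → IsParent e ∧ Y e) (λ e → depth (h e)))
      deepest = argmax-of _ _ (proj₁ some) (proj₂ some)
      e : Fin m
      e = proj₁ deepest
      pe : IsParent e ≡ true
      pe = ∧-elimˡ _ _ (proj₁ (proj₂ deepest))
      ye : Y e ≡ true
      ye = ∧-elimʳ (IsParent e) _ (proj₁ (proj₂ deepest))
      only-e : ∀ d → (h d ==ᶠ h e) ∧ Y d ≡ (d ==ᶠ e) ∧ true
      only-e d with d ==ᶠ e in de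
      ... | true rewrite ==ᶠ⇒≡ de = trans (cong (_∧ Y e) (==ᶠ-refl (h e))) ye
      ... | false with h d ==ᶠ h e in same | Y d in yd
      ...   | false | _     = refl
      ...   | true  | false = refl
      ...   | true  | true with ∨-elim (IsParent d) (IsParent (α d)) (Y⊆T d yd)
      ...     | inj₁ p = ⊥-elim (true≢false (trans (sym (≡⇒==ᶠ (IsParent-unique d e p pe (==ᶠ⇒≡ same)))) de))
      ...     | inj₂ p = ⊥-elim (<-irrefl refl (≤-<-trans deeper shallower))
        where
        deeper : depth (h (α d)) ≤ depth (h d)
        deeper = subst (λ z → depth (h (α d)) ≤ depth z) (sym (==ᶠ⇒≡ same))
                   (proj₂ (proj₂ deepest) (α d) (∧-intro p (trans (Yα d) yd)))
        shallower : depth (h d) < depth (h (α d))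
        shallower = subst (λ z → depth (h z) < depth (h (α d))) (α-invol d) (IsParent-depth (α d) p)
      once : countF (λ d → (h d ==ᶠ h e) ∧ Y d) ≡ 1
      once = trans (countF-cong only-e) (countF-single e (λ _ → true))

    -- the potential is the xor of b along the tree path to the root
    tree-potential : (b : Fin m → Bool) → (∀ d → b (α d) ≡ b d) → Potential InTree b
    tree-potential b bα = potential , potential-δ
      where
      parentOf : (x : Fin n) →
                 (∃ λ d → (h d ==ᶠ x) ∧ IsParent d ≡ true) ⊎ (∀ d → (h d ==ᶠ x) ∧ IsParent d ≡ false)
      parentOf x = search (λ d → (h d ==ᶠ x) ∧ IsParent d)

      pathXor : ℕ → Fin n → Bool
      pathXor zero    x = false
      pathXor (suc k) x with parentOf x
      ... | inj₁ (d , _) = b d xor pathXor k (h (α d))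
      ... | inj₂ _       = false

      pathXor-fuel : ∀ k k′ x → depth x < k → depth x < k′ → pathXor k x ≡ pathXor k′ x
      pathXor-fuel (suc k) (suc k′) x lt lt′ with parentOf x
      ... | inj₂ _ = refl
      ... | inj₁ (d , pd) = cong (b d xor_) (pathXor-fuel k k′ (h (α d)) (≤-trans closer (≤-pred lt))
                                                                         (≤-trans closer (≤-pred lt′)))
        where
        closer : depth (h (α d)) < depth x
        closer = subst (λ z → depth (h (α d)) < depth z) (==ᶠ⇒≡ (∧-elimˡ _ _ pd))
                       (IsParent-depth d (∧-elimʳ (h d ==ᶠ x) _ pd))

      potential : Fin n → Bool
      potential = pathXor (suc (suc n))

      potential-parent : ∀ d → IsParent d ≡ true → potential (h d) ≡ b d xor potential (h (α d))
      potential-parent d p with parentOf (h d)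
      ... | inj₂ none = ⊥-elim (true≢false (trans (sym (∧-intro (==ᶠ-refl (h d)) p)) (none d)))
      ... | inj₁ (d′ , pd′)
            with IsParent-unique d′ d (∧-elimʳ (h d′ ==ᶠ h d) _ pd′) p (==ᶠ⇒≡ (∧-elimˡ _ _ pd′))
      ... | refl = cong (b d xor_) (pathXor-fuel (suc n) (suc (suc n)) (h (α d))
                   (≤-trans (IsParent-depth d p) (depth-≤-bound (h d)))
                   (≤-trans (IsParent-depth d p) (m≤n⇒m≤1+n (depth-≤-bound (h d)))))

      parent-δ : ∀ d → IsParent d ≡ true → δ potential d ≡ b d
      parent-δ d p = trans (cong (_xor potential (h (α d))) (potential-parent d p)) (xor-xor-cancelʳ (b d) _)

      potential-δ : ∀ d → InTree d ≡ true → δ potential d ≡ b d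
      potential-δ d t = [ parent-δ d , (λ p → trans (sym (δ-α potential d)) (trans (parent-δ (α d) p) (bα d))) ]′
                          (∨-elim (IsParent d) (IsParent (α d)) t)

anyBelow-intro : ∀ (p : ℕ → Bool) M k → k < M → p k ≡ true → anyBelow M p ≡ true
anyBelow-intro p (suc M) k lt e with k Data.Nat.≟ M
... | yes refl = ∨-introˡ (p k) _ e
... | no  k≢M  = ∨-introʳ (p M) _ (anyBelow-intro p M k (≤∧≢⇒< (≤-pred lt) k≢M) e)

anyBelow-elim : ∀ (p : ℕ → Bool) M → anyBelow M p ≡ true → ∃ λ k → k < M × p k ≡ true
anyBelow-elim p (suc M) e with ∨-elim (p M) _ e
... | inj₁ q = M , ≤-refl , q
... | inj₂ q with anyBelow-elim p M q
... | k , lt , pk = k , m≤n⇒m≤1+n lt , pk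

allBelow-intro : ∀ (p : ℕ → Bool) M → (∀ k → k < M → p k ≡ true) → allBelow M p ≡ true
allBelow-intro p zero    f = refl
allBelow-intro p (suc M) f = ∧-intro (f M ≤-refl) (allBelow-intro p M (λ k lt → f k (m≤n⇒m≤1+n lt)))

allBelow-elim : ∀ (p : ℕ → Bool) M → allBelow M p ≡ true → ∀ k → k < M → p k ≡ true
allBelow-elim p (suc M) e k lt with k Data.Nat.≟ M
... | yes refl = ∧-elimˡ (p k) _ e
... | no  k≢M  = allBelow-elim p M (∧-elimʳ (p M) _ e) k (≤∧≢⇒< (≤-pred lt) k≢M)

module Orbits {N : ℕ} (φ ψ : Fin N → Fin N) (φψ : ∀ x → φ (ψ x) ≡ x) (ψφ : ∀ x → ψ (φ x) ≡ x) where

  iter-+ : ∀ a b x → iter φ (a + b) x ≡ iter φ a (iter φ b x)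
  iter-+ zero    b x = refl
  iter-+ (suc a) b x = cong φ (iter-+ a b x)

  iter-injective : ∀ k {x y} → iter φ k x ≡ iter φ k y → x ≡ y
  iter-injective zero    e = e
  iter-injective (suc k) {x} {y} e = iter-injective k (trans (sym (ψφ _)) (trans (cong ψ e) (ψφ _)))

  iter-comm : ∀ a b x → iter φ a (iter φ b x) ≡ iter φ b (iter φ a x)
  iter-comm a b x = trans (sym (iter-+ a b x)) (trans (cong (λ z → iter φ z x) (+-comm a b)) (iter-+ b a x))

  iter-multiple : ∀ d p → iter φ p d ≡ d → ∀ q → iter φ (q * p) d ≡ d
  iter-multiple d p e zero    = refl
  iter-multiple d p e (suc q) = trans (iter-+ p (q * p) d) (trans (cong (iter φ p) (iter-multiple d p e q)) e)

  -- by the pigeonhole principle, some 0 < p ≤ N returns d to itself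
  period : ∀ d → ∃ λ p → 0 < p × p ≤ N × iter φ p d ≡ d
  period d with FinP.pigeonhole (n<1+n N) (λ (i : Fin (suc N)) → iter φ (toℕ i) d)
  ... | i , j , i<j , e = toℕ j ∸ toℕ i , m<n⇒0<n∸m i<j ,
                          ≤-trans (m∸n≤m (toℕ j) (toℕ i)) (≤-pred (FinP.toℕ<n j)) , returns
    where
    returns : iter φ (toℕ j ∸ toℕ i) d ≡ d
    returns = iter-injective (toℕ i) (begin
      iter φ (toℕ i) (iter φ (toℕ j ∸ toℕ i) d) ≡⟨ iter-comm (toℕ i) (toℕ j ∸ toℕ i) d ⟩
      iter φ (toℕ j ∸ toℕ i) (iter φ (toℕ i) d) ≡⟨ sym (iter-+ (toℕ j ∸ toℕ i) (toℕ i) d) ⟩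
      iter φ (toℕ j ∸ toℕ i + toℕ i) d          ≡⟨ cong (λ z → iter φ z d) (m∸n+n≡m (<⇒≤ i<j)) ⟩
      iter φ (toℕ j) d                          ≡⟨ sym e ⟩
      iter φ (toℕ i) d                          ∎)
      where open ≡-Reasoning

  sameOrbit-intro : ∀ d d′ k → iter φ k d ≡ d′ → sameOrbit φ d d′ ≡ true
  sameOrbit-intro d d′ k e with period d
  ... | suc p , _ , p≤N , returns =
    anyBelow-intro _ N (k % suc p) (≤-trans (m%n<n k (suc p)) p≤N) (≡⇒==ᶠ (begin
      iter φ (k % suc p) d
        ≡⟨ cong (iter φ (k % suc p)) (sym (iter-multiple d (suc p) returns (k / suc p))) ⟩
      iter φ (k % suc p) (iter φ (k / suc p * suc p) d)    ≡⟨ sym (iter-+ (k % suc p) _ d) ⟩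
      iter φ (k % suc p + k / suc p * suc p) d             ≡⟨ cong (λ z → iter φ z d) (sym (m≡m%n+[m/n]*n k (suc p))) ⟩
      iter φ k d                                           ≡⟨ e ⟩
      d′                                                   ∎))
    where open ≡-Reasoning

  sameOrbit-elim : ∀ d d′ → sameOrbit φ d d′ ≡ true → ∃ λ k → iter φ k d ≡ d′
  sameOrbit-elim d d′ e with anyBelow-elim _ N e
  ... | k , _ , q = k , ==ᶠ⇒≡ q

  sameOrbit-refl : ∀ d → sameOrbit φ d d ≡ true
  sameOrbit-refl d = sameOrbit-intro d d 0 refl

  sameOrbit-trans : ∀ a b c → sameOrbit φ a b ≡ true → sameOrbit φ b c ≡ true → sameOrbit φ a c ≡ true
  sameOrbit-trans a b c e f with sameOrbit-elim a b e | sameOrbit-elim b c f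
  ... | k , ek | l , el = sameOrbit-intro a c (l + k) (trans (iter-+ l k a) (trans (cong (iter φ l) ek) el))

  sameOrbit-sym : ∀ a b → sameOrbit φ a b ≡ true → sameOrbit φ b a ≡ true
  sameOrbit-sym a b e with sameOrbit-elim a b e | period a
  ... | k , ek | suc p , _ , _ , returns = sameOrbit-intro b a (k * p) (begin
    iter φ (k * p) b               ≡⟨ cong (iter φ (k * p)) (sym ek) ⟩
    iter φ (k * p) (iter φ k a)    ≡⟨ sym (iter-+ (k * p) k a) ⟩
    iter φ (k * p + k) a           ≡⟨ cong (λ z → iter φ z a) (trans (+-comm (k * p) k) (sym (*-suc k p))) ⟩
    iter φ (k * suc p) a           ≡⟨ iter-multiple a (suc p) returns k ⟩
    a                              ∎)
    where open ≡-Reasoning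

  sameOrbit-φ : ∀ d → sameOrbit φ d (φ d) ≡ true
  sameOrbit-φ d = sameOrbit-intro d (φ d) 1 refl

  rep : Fin N → Fin N
  rep d = proj₁ (argmin-of (sameOrbit φ d) toℕ d (sameOrbit-refl d))

  rep-sameOrbit : ∀ d → sameOrbit φ d (rep d) ≡ true
  rep-sameOrbit d = proj₁ (proj₂ (argmin-of (sameOrbit φ d) toℕ d (sameOrbit-refl d)))

  rep-minimal : ∀ d e → sameOrbit φ d e ≡ true → toℕ (rep d) ≤ toℕ e
  rep-minimal d = proj₂ (proj₂ (argmin-of (sameOrbit φ d) toℕ d (sameOrbit-refl d)))

  rep-cong : ∀ d d′ → sameOrbit φ d d′ ≡ true → rep d ≡ rep d′
  rep-cong d d′ e = FinP.toℕ-injective (≤-antisym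
    (rep-minimal d (rep d′) (sameOrbit-trans d d′ (rep d′) e (rep-sameOrbit d′)))
    (rep-minimal d′ (rep d) (sameOrbit-trans d′ d (rep d) (sameOrbit-sym d d′ e) (rep-sameOrbit d))))

  rep≡⇒sameOrbit : ∀ d d′ → rep d ≡ rep d′ → sameOrbit φ d d′ ≡ true
  rep≡⇒sameOrbit d d′ e = sameOrbit-trans d (rep d) d′ (rep-sameOrbit d)
    (subst (λ z → sameOrbit φ z d′ ≡ true) (sym e) (sameOrbit-sym d′ (rep d′) (rep-sameOrbit d′)))

  rep-φ : ∀ d → rep (φ d) ≡ rep d
  rep-φ d = sym (rep-cong d (φ d) (sameOrbit-φ d))

  rep-idem : ∀ d → rep (rep d) ≡ rep d
  rep-idem d = sym (rep-cong d (rep d) (rep-sameOrbit d))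

  orbitRep-rep : ∀ d → orbitRep φ (rep d) ≡ true
  orbitRep-rep d = allBelow-intro _ N (λ k _ → T⇒≡true (≤⇒≤ᵇ (rep-minimal d (iter φ k (rep d))
    (sameOrbit-trans d (rep d) _ (rep-sameOrbit d) (sameOrbit-intro (rep d) _ k refl)))))

  orbitRep⇒rep≡ : ∀ x → orbitRep φ x ≡ true → rep x ≡ x
  orbitRep⇒rep≡ x e with anyBelow-elim _ N (rep-sameOrbit x)
  ... | k , lt , q = FinP.toℕ-injective (≤-antisym (rep-minimal x x (sameOrbit-refl x))
    (subst (λ z → toℕ x ≤ toℕ z) (==ᶠ⇒≡ q) (≤ᵇ⇒≤ _ _ (≡true⇒T (allBelow-elim _ N e k lt)))))

module _ (M : SemiMPG) where
  open SemiMPG M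

  ψ : Fin nD → Fin nD
  ψ d = α (σ⁻ d)

  φψ : ∀ d → φ (ψ d) ≡ d
  φψ d = trans (cong σ (α-invol (σ⁻ d))) (σσ⁻ d)

  ψφ : ∀ d → ψ (φ d) ≡ d
  ψφ d = trans (cong α (σ⁻σ (α d))) (α-invol d)

  module Face = Orbits φ ψ φψ ψφ

  module Whole = DartGraph α α-invol vert (λ _ → true) (λ _ → refl)
  open Whole using (δ)

  vert-φ : ∀ d → vert (φ d) ≡ vert (α d)
  vert-φ d = vert-σ (α d)

  vert-αφφ : ∀ d → outer d ≡ false → vert (α (φ (φ d))) ≡ vert d
  vert-αφφ d od = trans (sym (vert-φ (φ (φ d)))) (cong vert (triangular d od))

  inFace-φ : ∀ d d′ → inFace d (φ d′) ≡ inFace d d′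
  inFace-φ d d′ = Bool-ext
    (λ e → Face.sameOrbit-trans d (φ d′) d′ e (Face.sameOrbit-sym d′ (φ d′) (Face.sameOrbit-φ d′)))
    (λ e → Face.sameOrbit-trans d d′ (φ d′) e (Face.sameOrbit-φ d′))

  -- Coboundaries telescope along closed walks.

  δ-even-on-cycle : ∀ m w → IsCycle m w → (g : Fin nV → Bool) → odd (countF (λ i → δ g (w i))) ≡ false
  δ-even-on-cycle zero     w (() , _) g
  δ-even-on-cycle (suc m′) w (_ , next , _) g = begin
    odd (countF (λ i → δ g (w i)))                 ≡⟨ odd-countF-xor tails heads ⟩
    odd (countF tails) xor odd (countF heads)      ≡⟨ cong (λ z → odd (countF tails) xor odd z) rotated ⟩
    odd (countF tails) xor odd (countF tails)      ≡⟨ 𝔹.xor-same (odd (countF tails)) ⟩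
    false                                          ∎
    where
    open ≡-Reasoning
    tails heads : Fin (suc m′) → Bool
    tails i = g (vert (w i))
    heads i = g (vert (α (w i)))
    rotated : countF heads ≡ countF tails
    rotated = countF-rotate tails heads
      (λ i → cong g (next (inject₁ i) (fsuc i) (inj₁ (cong suc (FinP.toℕ-inject₁ i)))))
      (cong g (next (fromℕ m′) fzero (inj₂ (cong suc (FinP.toℕ-fromℕ m′) , refl))))

  δ-even-on-face : ∀ d₀ (g : Fin nV → Bool) → odd (countF (λ d → inFace d₀ d ∧ δ g d)) ≡ false
  δ-even-on-face d₀ g = trans
    (cong odd (countF-cong (λ d → cong (λ z → inFace d₀ d ∧ (g (vert d) xor g z)) (sym (vert-φ d)))))
    (odd-countF-coboundary φ ψ φψ ψφ (inFace d₀) (λ d → g (vert d)) (inFace-φ d₀))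

  potentials⇒FourColorable : (g₁ g₂ : Fin nV → Bool) → (∀ d → ¬ (δ g₁ d ≡ false × δ g₂ d ≡ false)) →
                             FourColorable
  potentials⇒FourColorable g₁ g₂ nonzero = (λ v → fromBits (g₁ v) (g₂ v)) , proper
    where
    proper : ∀ d → fromBits (g₁ (vert d)) (g₂ (vert d)) ≢ fromBits (g₁ (vert (α d))) (g₂ (vert (α d)))
    proper d e with fromBits-injective e
    ... | e₁ , e₂ = nonzero d (≡⇒xor≡false e₁ , ≡⇒xor≡false e₂)

  bitPotentials⇒FourColorable : (c : Fin nD → RGB) → Whole.Potential (λ _ → true) (λ d → bit₁ (c d)) →
                                Whole.Potential (λ _ → true) (λ d → bit₂ (c d)) → FourColorable
  bitPotentials⇒FourColorable c (g₁ , δg₁) (g₂ , δg₂) = potentials⇒FourColorable g₁ g₂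
    λ d (p , q) → bits-nonzero (c d) (trans (sym (δg₁ d refl)) p , trans (sym (δg₂ d refl)) q)

  -- A four-colouring f, read as a pair of potentials in 𝔽₂, colours each edge by the
  -- nonzero difference of the colours of its ends.
  module FromColouring (f : Fin nV → Fin 4) (proper : ∀ d → f (vert d) ≢ f (vert (α d))) where

    x y : Fin nV → Bool
    x v = lowBit (f v)
    y v = highBit (f v)

    δ-nonzero : ∀ d → ¬ (δ x d ≡ false × δ y d ≡ false)
    δ-nonzero d (p , q) = proper d (bits-injective (xor≡false⇒≡ _ _ p) (xor≡false⇒≡ _ _ q))

    colour : Fin nD → RGB
    colour d = rgb (δ x d) (δ y d)

    bit₁-colour : ∀ d → bit₁ (colour d) ≡ δ x d
    bit₁-colour d = proj₁ (rgb-bits (δ x d) (δ y d) (δ-nonzero d))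

    bit₂-colour : ∀ d → bit₂ (colour d) ≡ δ y d
    bit₂-colour d = proj₂ (rgb-bits (δ x d) (δ y d) (δ-nonzero d))

    colour-α : ∀ d → colour (α d) ≡ colour d
    colour-α d = cong₂ rgb (Whole.δ-α x d) (Whole.δ-α y d)

    same-colour-skip : ∀ d₁ d₂ → vert (α d₁) ≡ vert d₂ → colour d₁ ≡ colour d₂ →
                       f (vert d₁) ≡ f (vert (α d₂))
    same-colour-skip d₁ d₂ meet e = bits-injective
      (skip x (trans (sym (bit₁-colour d₁)) (trans (cong bit₁ e) (bit₁-colour d₂))))
      (skip y (trans (sym (bit₂-colour d₁)) (trans (cong bit₂ e) (bit₂-colour d₂))))
      where
      skip : (z : Fin nV → Bool) → δ z d₁ ≡ δ z d₂ → z (vert d₁) ≡ z (vert (α d₂))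
      skip z eq = xor-cancel-middle _ _ _ (trans eq (cong (λ v → z v xor z (vert (α d₂))) (sym meet)))

    rgbTiling : IsRGBTiling M colour
    rgbTiling = colour-α , λ d od → t₀₁ d od , t₁₂ d od , t₀₂ d od
      where
      t₀₁ : ∀ d → outer d ≡ false → colour d ≢ colour (φ d)
      t₀₁ d od e = proper (φ (φ d)) (trans (cong f (vert-φ (φ d)))
        (trans (sym (same-colour-skip d (φ d) (sym (vert-φ d)) e)) (cong f (sym (vert-αφφ d od)))))
      t₁₂ : ∀ d → outer d ≡ false → colour (φ d) ≢ colour (φ (φ d))
      t₁₂ d od e = proper d (trans (sym (trans (same-colour-skip (φ d) (φ (φ d)) (sym (vert-φ (φ d))) e)
                                                (cong f (vert-αφφ d od)))) (cong f (vert-φ d)))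
      t₀₂ : ∀ d → outer d ≡ false → colour d ≢ colour (φ (φ d))
      t₀₂ d od e = proper (φ d) (trans (cong f (vert-φ d))
        (trans (sym (same-colour-skip (φ (φ d)) d (vert-αφφ d od) (sym e))) (cong f (vert-φ (φ d)))))

    cycleParity : CycleParity M colour
    cycleParity m w cyc c = trans
      (ColourCounts.bitsEven⇒colourParities (λ _ → true) (λ i → colour (w i))
         (even x bit₁ bit₁-colour , even y bit₂ bit₂-colour) c)
      (cong (_% 2) (countF-all {m}))
      where
      even : (z : Fin nV → Bool) (bit : RGB → Bool) → (∀ d → bit (colour d) ≡ δ z d) →
             odd (countF (λ i → bit (colour (w i)))) ≡ false
      even z bit bit-colour = trans (cong odd (countF-cong (λ i → bit-colour (w i)))) (δ-even-on-cycle m w cyc z)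

    outerParity : OuterParity M colour
    outerParity d _ c =
      ColourCounts.bitsEven⇒colourParities (inFace d) colour (even x bit₁ bit₁-colour , even y bit₂ bit₂-colour) c
      where
      even : (z : Fin nV → Bool) (bit : RGB → Bool) → (∀ d → bit (colour d) ≡ δ z d) →
             odd (countF (λ d′ → inFace d d′ ∧ bit (colour d′))) ≡ false
      even z bit bit-colour =
        trans (cong odd (countF-cong (λ d′ → cong (inFace d d′ ∧_) (bit-colour d′)))) (δ-even-on-face d z)

    isRed : Fin nD → Bool
    isRed d = sameLowBit (f (vert d)) (f (vert (α d)))

    rTiling : IsRTiling isRed
    rTiling = red-α , one-red
      where
      red-α : ∀ d → isRed (α d) ≡ isRed d
      red-α d = cong not (Whole.δ-α x d)
      one-red : ∀ d → outer d ≡ false → ind (isRed d) + ind (isRed (φ d)) + ind (isRed (φ (φ d))) ≡ 1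
      one-red d od = trans
        (cong₂ _+_ (cong₂ _+_ (red≡ d (vert-φ d)) (red≡ (φ d) (vert-φ (φ d))))
                   (red≡ (φ (φ d)) (sym (vert-αφφ d od))))
        (distinct-sameLowBit-once (f (vert d)) (f (vert (φ d))) (f (vert (φ (φ d)))) (d₀₁ , d₁₂ , d₀₂))
        where
        red≡ : ∀ d′ {v} → v ≡ vert (α d′) → ind (isRed d′) ≡ ind (sameLowBit (f (vert d′)) (f v))
        red≡ d′ eq = cong (λ z → ind (sameLowBit (f (vert d′)) (f z))) (sym eq)
        d₀₁ : f (vert d) ≢ f (vert (φ d))
        d₀₁ e = proper d (trans e (cong f (vert-φ d)))
        d₁₂ : f (vert (φ d)) ≢ f (vert (φ (φ d)))
        d₁₂ e = proper (φ d) (trans e (cong f (vert-φ (φ d))))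
        d₀₂ : f (vert d) ≢ f (vert (φ (φ d)))
        d₀₂ e = proper (φ (φ d)) (trans (sym e) (cong f (sym (vert-αφφ d od))))

    grand : IsGrand isRed
    grand = x , black , redSame
      where
      black : ∀ d → isRed d ≡ false → x (vert d) ≢ x (vert (α d))
      black d r e = true≢false (trans (sym (cong not (≡⇒xor≡false e))) r)
      redSame : ∀ d → isRed d ≡ true → x (vert d) ≡ x (vert (α d))
      redSame d r = xor≡false⇒≡ _ _ (𝔹.not-injective r)

    -- along a red cycle the high bit alternates
    noRedOddCycle : ¬ HasRedOddCycle isRed
    noRedOddCycle (m , w , cyc , m-odd , allRed) = true≢false (begin
      true                              ≡⟨ ind-injective (trans (sym m-odd) (%2≡ind-odd m)) ⟩
      odd m                             ≡⟨ cong odd (sym (trans (countF-cong (λ i → highBit-flips (w i) (allRed i)))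
                                                                (countF-all {m}))) ⟩
      odd (countF (λ i → δ y (w i)))    ≡⟨ δ-even-on-cycle m w cyc y ⟩
      false                             ∎)
      where
      open ≡-Reasoning
      highBit-flips : ∀ d → isRed d ≡ true → δ y d ≡ true
      highBit-flips d r =
        ≢⇒xor≡true _ _ (λ e → proper d (bits-injective (xor≡false⇒≡ _ _ (𝔹.not-injective r)) e))

    colouring⇒B : StmtB M
    colouring⇒B = colour , rgbTiling , cycleParity

    colouring⇒C : StmtC M
    colouring⇒C = colour , rgbTiling , outerParity

    colouring⇒D : StmtD M
    colouring⇒D = isRed , rTiling , grand , noRedOddCycle

  -- A closed walk splits at a repeated vertex into two shorter closed walks; a closed walk
  -- without repeated vertices has length ≤ 2 (and then goes back and forth along an edge) or is a cycle.
  module CyclesEven (X : Fin nD → Bool) (X-α : ∀ d → X (α d) ≡ X d) (b : Fin nD → Bool) (bα : ∀ d → b (α d) ≡ b d)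
    (cycles-even : ∀ m w → IsCycle m w → (∀ i → X (w i) ≡ true) → odd (countF (λ i → b (w i))) ≡ false) where

    open DartGraph α α-invol vert X X-α

    xorAlong-lookup : ∀ ds → xorAlong b ds ≡ odd (countF (λ i → b (lookup ds i)))
    xorAlong-lookup []       = refl
    xorAlong-lookup (d ∷ ds) = sym (trans (odd-+ (ind (b d)) _) (cong₂ _xor_ (odd-ind (b d)) (sym (xorAlong-lookup ds))))

    walk-X : ∀ {u v ds} → Walk u v ds → ∀ i → X (lookup ds i) ≡ true
    walk-X (step x _ _) fzero    = x
    walk-X (step _ _ w) (fsuc i) = walk-X w i

    walk-first : ∀ {u v ds} → Walk u v ds → ∀ j → toℕ j ≡ 0 → vert (lookup ds j) ≡ u
    walk-first (step _ e _) fzero _ = e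

    walk-next : ∀ {u v ds} → Walk u v ds → ∀ i j → suc (toℕ i) ≡ toℕ j →
                vert (α (lookup ds i)) ≡ vert (lookup ds j)
    walk-next (step _ _ w) fzero    (fsuc j) q = sym (walk-first w j (sym (suc-injective q)))
    walk-next (step _ _ w) (fsuc i) (fsuc j) q = walk-next w i j (suc-injective q)

    walk-last : ∀ {u v ds} → Walk u v ds → ∀ i → suc (toℕ i) ≡ length ds → vert (α (lookup ds i)) ≡ v
    walk-last (step _ _ []) fzero    _ = refl
    walk-last (step _ _ w)  (fsuc i) q = walk-last w i (suc-injective q)

    DistinctVertices : List (Fin nD) → Set
    DistinctVertices ds = ∀ i j → vert (lookup ds i) ≡ vert (lookup ds j) → i ≡ j

    RepeatedVertex : List (Fin nD) → Set
    RepeatedVertex ds = ∃ λ as → ∃ λ b₀ → ∃ λ bs → ∃ λ c₀ → ∃ λ cs →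
      ds ≡ as ++ (b₀ ∷ bs) ++ (c₀ ∷ cs) × vert b₀ ≡ vert c₀

    private
      occurrence : ∀ d xs → (∃ λ ys → ∃ λ c → ∃ λ zs → xs ≡ ys ++ (c ∷ zs) × vert d ≡ vert c)
                            ⊎ (∀ i → vert (lookup xs i) ≢ vert d)
      occurrence d []       = inj₂ (λ ())
      occurrence d (x ∷ xs) with vert d FinP.≟ vert x
      ... | yes p = inj₁ ([] , x , xs , refl , p)
      ... | no ¬p with occurrence d xs
      ...   | inj₁ (ys , c , zs , eq , e) = inj₁ (x ∷ ys , c , zs , cong (x ∷_) eq , e)
      ...   | inj₂ none = inj₂ λ { fzero e → ¬p (sym e) ; (fsuc i) e → none i e }

    repeated-or-distinct : ∀ ds → RepeatedVertex ds ⊎ DistinctVertices ds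
    repeated-or-distinct []       = inj₂ (λ ())
    repeated-or-distinct (d ∷ ds) with occurrence d ds
    ... | inj₁ (ys , c , zs , eq , e) = inj₁ ([] , d , ys , c , zs , cong (d ∷_) eq , e)
    ... | inj₂ none with repeated-or-distinct ds
    ...   | inj₁ (as , b₀ , bs , c₀ , cs , eq , e) = inj₁ (d ∷ as , b₀ , bs , c₀ , cs , cong (d ∷_) eq , e)
    ...   | inj₂ dist = inj₂ λ { fzero    fzero    _ → refl
                               ; fzero    (fsuc j) e → ⊥-elim (none j (sym e))
                               ; (fsuc i) fzero    e → ⊥-elim (none i e)
                               ; (fsuc i) (fsuc j) e → cong fsuc (dist i j e) }

    distinct-closedWalk-even : ∀ {u ds} → Walk u u ds → DistinctVertices ds → xorAlong b ds ≡ false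
    distinct-closedWalk-even {ds = []}    _ _ = refl
    distinct-closedWalk-even {ds = d ∷ []} (step _ hd w) _ = ⊥-elim (loopless d (trans (walk-empty w) (sym hd)))
    distinct-closedWalk-even {ds = d ∷ e ∷ []} (step _ hd (step _ he w)) _
      with no-multi e (α d) he (trans (walk-empty w) (trans (sym hd) (cong vert (sym (α-invol d)))))
    ... | refl = trans (cong (b d xor_) (trans (𝔹.xor-identityʳ (b (α d))) (bα d))) (𝔹.xor-same (b d))
    distinct-closedWalk-even {ds = ds@(_ ∷ _ ∷ _ ∷ _)} w dist =
      trans (xorAlong-lookup ds) (cycles-even (length ds) (lookup ds) isCycle (walk-X w))
      where
      isCycle : IsCycle (length ds) (lookup ds)
      isCycle = s≤s (s≤s (s≤s z≤n)) ,
        (λ { i j (inj₁ q) → walk-next w i j q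
           ; i j (inj₂ (p , q)) → trans (walk-last w i p) (sym (walk-first w j q)) }) ,
        dist

    closedWalk-even : ∀ L {u ds} → length ds ≤ L → Walk u u ds → xorAlong b ds ≡ false
    closedWalk-even zero    {ds = []}    _  _ = refl
    closedWalk-even (suc L) {u} {ds} le w with repeated-or-distinct ds
    ... | inj₂ dist = distinct-closedWalk-even w dist
    ... | inj₁ (as , b₀ , bs , c₀ , cs , refl , same) = begin
      xorAlong b (as ++ (b₀ ∷ bs) ++ (c₀ ∷ cs))
        ≡⟨ xorAlong-++ b as _ ⟩
      xorAlong b as xor xorAlong b ((b₀ ∷ bs) ++ (c₀ ∷ cs))
        ≡⟨ cong (xorAlong b as xor_) (xorAlong-++ b (b₀ ∷ bs) (c₀ ∷ cs)) ⟩
      xorAlong b as xor (xorAlong b (b₀ ∷ bs) xor xorAlong b (c₀ ∷ cs))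
        ≡⟨ cong (λ z → xorAlong b as xor (z xor xorAlong b (c₀ ∷ cs))) (closedWalk-even L loop-short loop) ⟩
      xorAlong b as xor xorAlong b (c₀ ∷ cs)
        ≡⟨ sym (xorAlong-++ b as (c₀ ∷ cs)) ⟩
      xorAlong b (as ++ (c₀ ∷ cs))
        ≡⟨ closedWalk-even L rest-short rest ⟩
      false ∎
      where
      open ≡-Reasoning
      A B C : ℕ
      A = length as
      B = length bs
      C = length cs
      split₁ : ∃ λ z → Walk u z as × Walk z u ((b₀ ∷ bs) ++ (c₀ ∷ cs))
      split₁ = walk-split as w
      split₂ : ∃ λ z → Walk (proj₁ split₁) z (b₀ ∷ bs) × Walk z u (c₀ ∷ cs)
      split₂ = walk-split (b₀ ∷ bs) (proj₂ (proj₂ split₁))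
      toLoop : proj₁ split₁ ≡ vert b₀
      toLoop = sym (walk-start (proj₁ (proj₂ split₂)))
      fromLoop : proj₁ split₂ ≡ vert b₀
      fromLoop = trans (sym (walk-start (proj₂ (proj₂ split₂)))) (sym same)
      loop : Walk (vert b₀) (vert b₀) (b₀ ∷ bs)
      loop = castˡ toLoop (castʳ fromLoop (proj₁ (proj₂ split₂)))
      rest : Walk u u (as ++ (c₀ ∷ cs))
      rest = proj₁ (proj₂ split₁) ++ʷ castˡ (trans fromLoop (sym toLoop)) (proj₂ (proj₂ split₂))
      total : A + (suc B + suc C) ≤ suc L
      total = subst (_≤ suc L) (trans (ListP.length-++ as) (cong (A +_) (ListP.length-++ (b₀ ∷ bs)))) le
      drop-suc : ∀ a c → a + suc c ≤ suc L → a ≤ L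
      drop-suc a c le′ = ≤-trans (m≤m+n a c) (≤-pred (subst (_≤ suc L) (+-suc a c) le′))
      loop-short : suc B ≤ L
      loop-short = drop-suc (suc B) C (≤-trans (m≤n+m (suc B + suc C) A) total)
      rest-short : length (as ++ (c₀ ∷ cs)) ≤ L
      rest-short = subst (_≤ L) (sym (ListP.length-++ as)) (drop-suc (A + suc C) B (subst (_≤ suc L) rearrange total))
        where
        rearrange : A + (suc B + suc C) ≡ A + suc C + suc B
        rearrange = trans (cong (A +_) (+-comm (suc B) (suc C))) (sym (+-assoc A (suc C) (suc B)))

    cyclesEven⇒potential : Potential X b
    cyclesEven⇒potential = closedWalksEven⇒potential b bα (λ {_} {ds} → closedWalk-even (length ds) ≤-refl)

  -- By (b) each bit of the RGB-colouring is even on every cycle, hence a coboundary.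
  B⇒colouring : StmtB M → FourColorable
  B⇒colouring (c , (c-α , _) , parity) =
    bitPotentials⇒FourColorable c (potential bit₁ (λ m w cyc → proj₁ (bitsEven m w cyc)))
                                  (potential bit₂ (λ m w cyc → proj₂ (bitsEven m w cyc)))
    where
    bitsEven : ∀ m w → IsCycle m w → ColourCounts.BitsEven (λ _ → true) (λ i → c (w i))
    bitsEven m w cyc = ColourCounts.colourParities⇒bitsEven (λ _ → true) (λ i → c (w i))
      (λ col → trans (parity m w cyc col) (cong (_% 2) (sym (countF-all {m}))))
    potential : (bit : RGB → Bool) → (∀ m w → IsCycle m w → odd (countF (λ i → bit (c (w i)))) ≡ false) →
                Whole.Potential (λ _ → true) (λ d → bit (c d))
    potential bit even = CyclesEven.cyclesEven⇒potential (λ _ → true) (λ _ → refl) (λ d → bit (c d))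
      (λ d → cong bit (c-α d)) (λ m w cyc _ → even m w cyc)

  -- The red edges form a bipartite graph, and the black edges are cut by the grand partition.
  D⇒colouring : StmtD M → FourColorable
  D⇒colouring (isRed , (red-α , _) , (part , black , _) , noOddRed) =
    potentials⇒FourColorable part (proj₁ redPotential) nonzero
    where
    redPotential : DartGraph.Potential α α-invol vert isRed red-α isRed (λ _ → true)
    redPotential = CyclesEven.cyclesEven⇒potential isRed red-α (λ _ → true) (λ _ → refl) evenRedCycles
      where
      evenRedCycles : ∀ m w → IsCycle m w → (∀ i → isRed (w i) ≡ true) →
                      odd (countF (λ (_ : Fin m) → true)) ≡ false
      evenRedCycles m w cyc allRed = trans (cong odd (countF-all {m})) (𝔹.¬-not λ oddLength →
        noOddRed (m , w , cyc , trans (%2≡ind-odd m) (cong ind oddLength) , allRed))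
    nonzero : ∀ d → ¬ (δ part d ≡ false × δ (proj₁ redPotential) d ≡ false)
    nonzero d (p , q) with true⊎false (isRed d)
    ... | inj₁ r = true≢false (trans (sym (proj₂ redPotential d r)) q)
    ... | inj₂ b = black d b (xor≡false⇒≡ _ _ p)

  -- Euler's formula rules out the empty map.
  someDart : Fin nD
  someDart with inhabited nD
    where
    inhabited : ∀ k → (Fin k → ⊥) ⊎ Fin k
    inhabited zero    = inj₁ (λ ())
    inhabited (suc k) = inj₂ fzero
  ... | inj₂ d      = d
  ... | inj₁ noDart = ⊥-elim (0≢4 (begin
    0                                ≡⟨ cong₂ (λ v f → 2 * v + 2 * f) (sym (empty (λ v → noDart (proj₁ (vert-surj v)))))
                                                                     (sym (countF-none (λ d → ⊥-elim (noDart d)))) ⟩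
    2 * nV + 2 * orbitCount φ        ≡⟨ euler ⟩
    nD + 4                           ≡⟨ cong (_+ 4) (empty noDart) ⟩
    4                                ∎))
    where
    open ≡-Reasoning
    empty : ∀ {k} → (Fin k → ⊥) → k ≡ 0
    empty {k} none = trans (sym (countF-all {k})) (countF-none (λ i → ⊥-elim (none i)))
    0≢4 : 0 ≢ 4
    0≢4 ()

  Reach⇒Walk : ∀ {d d′} → Reach α σ d d′ → ∃ λ ds → Whole.Walk (vert d) (vert d′) ds
  Reach⇒Walk here         = [] , Whole.[]
  Reach⇒Walk {d} (stepσ r) = proj₁ (Reach⇒Walk r) , Whole.castˡ (vert-σ d) (proj₂ (Reach⇒Walk r))
  Reach⇒Walk {d} (stepα r) = d ∷ proj₁ (Reach⇒Walk r) , Whole.step refl refl (proj₂ (Reach⇒Walk r))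

  -- In a plane map the darts off a spanning tree form a spanning tree of the dual map.
  module Duality where

    Primal-connected : ∀ v → true ≡ true → Whole.Connected (vert someDart) v ≡ true
    Primal-connected v _ with vert-surj v
    ... | d , refl = Whole.Walk⇒Connected (proj₂ (Reach⇒Walk (connected d someDart)))

    module Primal = Whole.SpanningTree (λ _ → true) (λ _ → refl) (vert someDart) refl Primal-connected

    InPrimalTree Cotree : Fin nD → Bool
    InPrimalTree = Primal.InTree
    Cotree d = not (InPrimalTree d)

    Cotree-α : ∀ d → Cotree (α d) ≡ Cotree d
    Cotree-α d = cong not (trans (cong (λ z → Primal.IsParent (α d) ∨ Primal.IsParent z) (α-invol d))
                            (𝔹.∨-comm (Primal.IsParent (α d)) (Primal.IsParent d)))

    module Dual = DartGraph α α-invol Face.rep Cotree Cotree-α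

    rootFace : Fin nD
    rootFace = Face.rep someDart

    Reached : Fin nD → Bool
    Reached x = Dual.Connected rootFace x

    rep-σ : ∀ d → Face.rep (σ d) ≡ Face.rep (α d)
    rep-σ d = trans (cong Face.rep (sym (cong σ (α-invol d)))) (Face.rep-φ (α d))

    Cut : Fin nD → Bool
    Cut d = Reached (Face.rep d) xor Reached (Face.rep (α d))

    Cut⊆InPrimalTree : Cut ⊆ᵇ InPrimalTree
    Cut⊆InPrimalTree d cut = 𝔹.¬-not λ q → true≢false (trans (sym cut) (≡⇒xor≡false
      (Bool-ext (Dual.Connected-forth d (cong not q)) (Dual.Connected-back d (cong not q)))))

    Cut-α : ∀ d → Cut (α d) ≡ Cut d
    Cut-α d = trans (cong (λ z → Reached (Face.rep (α d)) xor Reached (Face.rep z)) (α-invol d))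
                    (𝔹.xor-comm (Reached (Face.rep (α d))) (Reached (Face.rep d)))

    -- around a vertex the faces of σ d and α d coincide, so the cut is a coboundary there
    Cut-even : ∀ v → odd (countF (λ d → (vert d ==ᶠ v) ∧ Cut d)) ≡ false
    Cut-even v = trans
      (cong odd (countF-cong (λ d → cong (λ z → (vert d ==ᶠ v) ∧ (Reached (Face.rep d) xor Reached z))
                                         (sym (rep-σ d)))))
      (odd-countF-coboundary σ σ⁻ σσ⁻ σ⁻σ (λ d → vert d ==ᶠ v) (λ d → Reached (Face.rep d))
                             (λ d → cong (_==ᶠ v) (vert-σ d)))

    cross-or-continue : ∀ d → Reached (Face.rep d) ≡ false →
      (Reached (Face.rep (α d)) ≡ false → ∃ λ e → Cut e ≡ true) → ∃ λ e → Cut e ≡ true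
    cross-or-continue d out continue =
      [ (λ across → d , cong₂ _xor_ out across) , continue ]′ (true⊎false (Reached (Face.rep (α d))))

    crossing : ∀ d d′ → Reach α σ d d′ → Reached (Face.rep d) ≡ false → Reached (Face.rep d′) ≡ true →
               ∃ λ e → Cut e ≡ true
    crossing d .d here      out in′ = ⊥-elim (true≢false (trans (sym in′) out))
    crossing d d′ (stepσ r) out in′ = cross-or-continue d out λ across →
      crossing (σ d) d′ r (trans (cong Reached (rep-σ d)) across) in′
    crossing d d′ (stepα r) out in′ = cross-or-continue d out λ across → crossing (α d) d′ r across in′

    -- an unreached face would make the cut nonempty, but the cut is an even set of tree darts
    dual-connected : ∀ x → orbitRep φ x ≡ true → Reached x ≡ true
    dual-connected x rep-x = 𝔹.¬-not λ unreached →
      let (e , cut) = crossing x someDart (connected x someDart)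
                        (trans (cong Reached (Face.orbitRep⇒rep≡ x rep-x)) unreached) (Dual.Connected-refl rootFace)
      in true≢false (trans (sym cut) (Primal.tree-acyclic Cut Cut⊆InPrimalTree Cut-α Cut-even e))

    module DualTree = Dual.SpanningTree (orbitRep φ) Face.orbitRep-rep rootFace (Face.orbitRep-rep someDart) dual-connected

    InDualTree : Fin nD → Bool
    InDualTree = DualTree.InTree

    DualTree⊆Cotree : InDualTree ⊆ᵇ Cotree
    DualTree⊆Cotree d t =
      [ DualTree.IsParent⇒X d , (λ p → trans (sym (Cotree-α d)) (DualTree.IsParent⇒X (α d) p)) ]′
      (∨-elim (DualTree.IsParent d) (DualTree.IsParent (α d)) t)

    -- Euler's formula: the two spanning trees together need all the darts.
    Cotree-small : countF Cotree ≤ countF InDualTree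
    Cotree-small = +-cancelˡ-≤ (countF InPrimalTree) _ _ (+-cancelʳ-≤ 4 _ _ (begin
      countF InPrimalTree + countF Cotree + 4          ≡⟨ cong (_+ 4) (countF-not InPrimalTree) ⟩
      nD + 4                                           ≡⟨ sym euler ⟩
      2 * nV + 2 * orbitCount φ                        ≤⟨ +-mono-≤ primal DualTree.count-InTree ⟩
      (countF InPrimalTree + 2) + (countF InDualTree + 2)   ≡⟨ regroup (countF InPrimalTree) (countF InDualTree) ⟩
      countF InPrimalTree + countF InDualTree + 4      ∎))
      where
      open ≤-Reasoning
      primal : 2 * nV ≤ countF InPrimalTree + 2
      primal = subst (λ k → 2 * k ≤ countF InPrimalTree + 2) (countF-all {nV}) Primal.count-InTree
      regroup : ∀ p q → (p + 2) + (q + 2) ≡ p + q + 4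
      regroup p q = trans (+-assoc p 2 (q + 2)) (trans (cong (p +_) (trans (+-comm 2 (q + 2)) (+-assoc q 2 2)))
                                                       (sym (+-assoc p q 4)))

    Cotree⊆DualTree : Cotree ⊆ᵇ InDualTree
    Cotree⊆DualTree = countF-⊆-≥ DualTree⊆Cotree Cotree-small

  -- The tree potential g of b leaves b + δ g on the cotree, which is a dual spanning tree;
  -- b + δ g is even around every face, so it vanishes.
  facesEven⇒potential : (b : Fin nD → Bool) → (∀ d → b (α d) ≡ b d) →
    (∀ d₀ → odd (countF (λ d → inFace d₀ d ∧ b d)) ≡ false) → Whole.Potential (λ _ → true) b
  facesEven⇒potential b bα faces-even =
    g , λ d _ → sym (xor≡false⇒≡ _ _ (DualTree.tree-acyclic Y Y⊆DualTree Y-α Y-even d))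
    where
    open Duality
    treePotential : Whole.Potential InPrimalTree b
    treePotential = Primal.tree-potential b bα
    g : Fin nV → Bool
    g = proj₁ treePotential
    Y : Fin nD → Bool
    Y d = b d xor δ g d
    Y⊆DualTree : Y ⊆ᵇ InDualTree
    Y⊆DualTree d y = Cotree⊆DualTree d (cong not (𝔹.¬-not λ t →
      true≢false (trans (sym y) (≡⇒xor≡false (sym (proj₂ treePotential d t))))))
    Y-α : ∀ d → Y (α d) ≡ Y d
    Y-α d = cong₂ _xor_ (bα d) (Whole.δ-α g d)
    face-of : ∀ x → Face.rep x ≡ x → ∀ d → (Face.rep d ==ᶠ x) ≡ inFace x d
    face-of x rx d = Bool-ext (λ e → Face.rep≡⇒sameOrbit x d (trans rx (sym (==ᶠ⇒≡ e))))
                              (λ e → ≡⇒==ᶠ (trans (sym (Face.rep-cong x d e)) rx))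
    even-at : ∀ x → Dec (Face.rep x ≡ x) → odd (countF (λ d → (Face.rep d ==ᶠ x) ∧ Y d)) ≡ false
    even-at x (yes rx) = begin
      odd (countF (λ d → (Face.rep d ==ᶠ x) ∧ Y d))
        ≡⟨ cong odd (countF-cong (λ d → cong (_∧ Y d) (face-of x rx d))) ⟩
      odd (countF (λ d → inFace x d ∧ Y d))
        ≡⟨ odd-countF-∧-xor (inFace x) b (δ g) ⟩
      odd (countF (λ d → inFace x d ∧ b d)) xor odd (countF (λ d → inFace x d ∧ δ g d))
        ≡⟨ cong₂ _xor_ (faces-even x) (δ-even-on-face x g) ⟩
      false ∎
      where open ≡-Reasoning
    even-at x (no ¬rx) = cong odd (countF-none (λ d → cong (_∧ Y d) (≢⇒==ᶠ λ e → ¬rx (begin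
      Face.rep x              ≡⟨ cong Face.rep (sym e) ⟩
      Face.rep (Face.rep d)   ≡⟨ Face.rep-idem d ⟩
      Face.rep d              ≡⟨ e ⟩
      x                       ∎))))
      where open ≡-Reasoning
    Y-even : ∀ x → odd (countF (λ d → (Face.rep d ==ᶠ x) ∧ Y d)) ≡ false
    Y-even x = even-at x (Face.rep x FinP.≟ x)

  triangle-face : ∀ d₀ → outer d₀ ≡ false → ∀ d →
                  inFace d₀ d ≡ (d ==ᶠ d₀) ∨ ((d ==ᶠ φ d₀) ∨ (d ==ᶠ φ (φ d₀)))
  triangle-face d₀ od d = Bool-ext
    (λ e → let (k , reaches) = Face.sameOrbit-elim d₀ d e in
           listed (k % 3) (m%n<n k 3) (trans (sym (mod3 k)) reaches))
    (λ e → [ (λ q → Face.sameOrbit-intro d₀ d 0 (sym (==ᶠ⇒≡ q))) ,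
             (λ e′ → [ (λ q → Face.sameOrbit-intro d₀ d 1 (sym (==ᶠ⇒≡ q))) ,
                       (λ q → Face.sameOrbit-intro d₀ d 2 (sym (==ᶠ⇒≡ q))) ]′ (∨-elim _ _ e′)) ]′ (∨-elim _ _ e))
    where
    mod3 : ∀ k → iter φ k d₀ ≡ iter φ (k % 3) d₀
    mod3 k = begin
      iter φ k d₀                                  ≡⟨ cong (λ z → iter φ z d₀) (m≡m%n+[m/n]*n k 3) ⟩
      iter φ (k % 3 + k / 3 * 3) d₀                ≡⟨ Face.iter-+ (k % 3) _ d₀ ⟩
      iter φ (k % 3) (iter φ (k / 3 * 3) d₀)
        ≡⟨ cong (iter φ (k % 3)) (Face.iter-multiple d₀ 3 (triangular d₀ od) (k / 3)) ⟩
      iter φ (k % 3) d₀                            ∎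
      where open ≡-Reasoning
    listed : ∀ j → j < 3 → iter φ j d₀ ≡ d → (d ==ᶠ d₀) ∨ ((d ==ᶠ φ d₀) ∨ (d ==ᶠ φ (φ d₀))) ≡ true
    listed 0 _ e = ∨-introˡ _ _ (≡⇒==ᶠ (sym e))
    listed 1 _ e = ∨-introʳ (d ==ᶠ d₀) _ (∨-introˡ _ _ (≡⇒==ᶠ (sym e)))
    listed 2 _ e = ∨-introʳ (d ==ᶠ d₀) _ (∨-introʳ (d ==ᶠ φ d₀) _ (≡⇒==ᶠ (sym e)))
    listed (suc (suc (suc _))) (s≤s (s≤s (s≤s ()))) _

  -- Triangles carry three distinct colours; on the outer facets the bits are even by (c).
  C⇒colouring : StmtC M → FourColorable
  C⇒colouring (c , (c-α , triangles) , parity) =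
    bitPotentials⇒FourColorable c
      (facesEven⇒potential (λ d → bit₁ (c d)) (λ d → cong bit₁ (c-α d)) (λ d₀ → proj₁ (bitsEven d₀)))
      (facesEven⇒potential (λ d → bit₂ (c d)) (λ d → cong bit₂ (c-α d)) (λ d₀ → proj₂ (bitsEven d₀)))
    where
    triangleBitsEven : ∀ d₀ → outer d₀ ≡ false → ColourCounts.BitsEven (inFace d₀) c
    triangleBitsEven d₀ od =
      trans (cong odd (count bit₁)) (proj₁ sums) , trans (cong odd (count bit₂)) (proj₂ sums)
      where
      distinct : Distinct3 (c d₀) (c (φ d₀)) (c (φ (φ d₀)))
      distinct = triangles d₀ od
      count : ∀ bit → countF (λ d → inFace d₀ d ∧ bit (c d))
                        ≡ ind (bit (c d₀)) + (ind (bit (c (φ d₀))) + ind (bit (c (φ (φ d₀)))))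
      count bit = trans (countF-cong (λ d → cong (_∧ bit (c d)) (triangle-face d₀ od d)))
        (countF-three d₀ (φ d₀) (φ (φ d₀)) (Distinct3-map⁻ c distinct) (λ d → bit (c d)))
      sums : odd (ind (bit₁ (c d₀)) + (ind (bit₁ (c (φ d₀))) + ind (bit₁ (c (φ (φ d₀)))))) ≡ false ×
             odd (ind (bit₂ (c d₀)) + (ind (bit₂ (c (φ d₀))) + ind (bit₂ (c (φ (φ d₀)))))) ≡ false
      sums = distinct-colours-sum-even (c d₀) (c (φ d₀)) (c (φ (φ d₀))) distinct
    bitsEven : ∀ d₀ → ColourCounts.BitsEven (inFace d₀) c
    bitsEven d₀ = [ (λ o → ColourCounts.colourParities⇒bitsEven (inFace d₀) c (parity d₀ o)) ,
                    triangleBitsEven d₀ ]′ (true⊎false (outer d₀))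

theorem7p12 : (M : SemiMPG) →
    (StmtA M ⇔ StmtB M) × (StmtA M ⇔ StmtC M) × (StmtA M ⇔ StmtD M)
theorem7p12 M =
  mk⇔ (λ (f , proper) → FromColouring.colouring⇒B M f proper) (B⇒colouring M) ,
  mk⇔ (λ (f , proper) → FromColouring.colouring⇒C M f proper) (C⇒colouring M) ,
  mk⇔ (λ (f , proper) → FromColouring.colouring⇒D M f proper) (D⇒colouring M)
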